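{- Let $G$ be a graph and let $m,n\in\mathbb{N}$ with $m<n$. Then \[\omega(G^{\frac{m}{n}})=\begin{cases} m+1 & \text{if } \Delta(G)=1,\\ \frac{m}{2}\Delta(G)+1 & \text{if } \Delta(G)\geq 2 \text{ and } m\equiv 0 \pmod 2,\\ \frac{m-1}{2}\Delta(G)+2 & \text{if } \Delta(G)\geq 2 \text{ and } m\equiv 1 \pmod 2.\end{cases}\]
   Context: All graphs are finite and simple. $\Delta(G)$ is the maximum degree and $\omega(H)$ the clique number of a graph $H$. For $k\in\mathbb{N}$, the $k$-power $H^k$ of a graph $H$ has vertex set $V(H)$, with two distinct vertices $x,y$ adjacent iff $1\le d_H(x,y)\le k$. For $n\in\mathbb{N}$, the $n$-subdivision $G^{\frac1n}$ is obtained from $G$ by replacing each edge by a path of length $n$ (with $n-1$ new internal vertices per edge). The fractional power $G^{\frac{m}{n}}$ is defined as $(G^{\frac1n})^m$, the $m$-power of the $n$-subdivision of $G$. -}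

module Defs where

open import Data.Nat using (ℕ; zero; suc; _+_; _*_; _∸_; _≤_; _<_; _⊔_)
open import Data.Fin using (Fin; toℕ)
open import Data.Bool using (Bool; true; false; if_then_else_)
open import Data.List using (List; length; map; foldr; allFin)
open import Data.Nat.ListAction using (sum)
open import Data.List.Relation.Unary.AllPairs using (AllPairs)
open import Data.Product using (Σ; ∃; _×_; _,_; proj₁; proj₂)
open import Data.Sum using (_⊎_)
open import Data.Empty using (⊥)
open import Relation.Nullary using (¬_)
open import Relation.Binary.PropositionalEquality using (_≡_; _≢_)

record FinGraph : Set where
  field
    k      : ℕ
    adj    : Fin k → Fin k → Bool
    sym    : ∀ x y → adj x y ≡ adj y x
    irrefl : ∀ x → adj x x ≡ false

record Graph : Set₁ where
  field
    V      : Set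
    E      : V → V → Set
    symE   : ∀ {x y} → E x y → E y x
    irrefE : ∀ {x} → E x x → ⊥

open FinGraph
open Graph

toGraph : FinGraph → Graph
toGraph G = record
  { V = Fin (k G) ; E = λ x y → adj G x y ≡ true
  ; symE = λ {x} {y} e → Relation.Binary.PropositionalEquality.trans (sym G y x) e
  ; irrefE = λ {x} e → bad (Relation.Binary.PropositionalEquality.trans (Relation.Binary.PropositionalEquality.sym (irrefl G x)) e) }
  where
  bad : false ≡ true → ⊥
  bad ()

degree : (G : FinGraph) → Fin (k G) → ℕ
degree G x = sum (map (λ y → if adj G x y then 1 else 0) (allFin (k G)))

Δ : FinGraph → ℕ
Δ G = foldr _⊔_ 0 (map (degree G) (allFin (k G)))

-- An edge of G is recorded once, as (x , y) with x < y and adj x y.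
-- Its n-1 internal vertices are (e , i), i : Fin (n ∸ 1); the internal
-- vertex (e , i) lies at distance (toℕ i + 1) from x along the new path
-- x = p₀ , p₁ , … , pₙ = y.

EdgeOf : FinGraph → Set
EdgeOf G = Σ (Fin (k G)) λ x → Σ (Fin (k G)) λ y → (toℕ x < toℕ y) × (adj G x y ≡ true)

SubV : FinGraph → ℕ → Set
SubV G n = Fin (k G) ⊎ (EdgeOf G × Fin (n ∸ 1))

-- directed "next step along a path" relation; adjacency is its symmetric closure
data Step (G : FinGraph) (n : ℕ) : SubV G n → SubV G n → Set where
  -- n = 1: original edges are kept
  orig-orig : ∀ (e : EdgeOf G) → n ≡ 1 →
              Step G n (_⊎_.inj₁ (proj₁ e)) (_⊎_.inj₁ (proj₁ (proj₂ e)))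
  orig-in   : ∀ (e : EdgeOf G) (i : Fin (n ∸ 1)) → toℕ i ≡ 0 →
              Step G n (_⊎_.inj₁ (proj₁ e)) (_⊎_.inj₂ (e , i))
  in-in     : ∀ (e : EdgeOf G) (i j : Fin (n ∸ 1)) → toℕ j ≡ suc (toℕ i) →
              Step G n (_⊎_.inj₂ (e , i)) (_⊎_.inj₂ (e , j))
  in-orig   : ∀ (e : EdgeOf G) (i : Fin (n ∸ 1)) → suc (toℕ i) ≡ n ∸ 1 →
              Step G n (_⊎_.inj₂ (e , i)) (_⊎_.inj₁ (proj₁ (proj₂ e)))

SubE : (G : FinGraph) (n : ℕ) → SubV G n → SubV G n → Set
SubE G n u v = Step G n u v ⊎ Step G n v u

data Walk (H : Graph) : V H → V H → ℕ → Set where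
  nil  : ∀ {x} → Walk H x x 0
  cons : ∀ {x y z l} → E H x y → Walk H y z l → Walk H x z (suc l)

DistLe : (H : Graph) → V H → V H → ℕ → Set
DistLe H x y j = ∃ λ l → l ≤ j × Walk H x y l

PowE : (H : Graph) → ℕ → V H → V H → Set
PowE H j x y = x ≢ y × DistLe H x y j

-- a clique is a list of pairwise adjacent (hence distinct, as adjacency
-- below is irreflexive) vertices
IsClique : {A : Set} → (A → A → Set) → List A → Set
IsClique R xs = AllPairs R xs

IsCliqueNumber : {A : Set} → (A → A → Set) → ℕ → Set
IsCliqueNumber {A} R c =
  (∃ λ (xs : List A) → IsClique R xs × length xs ≡ c) ×
  (∀ (xs : List A) → IsClique R xs → length xs ≤ c)

Subdivision : FinGraph → ℕ → Graph
Subdivision G n = record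
  { V = SubV G n ; E = SubE G n
  ; symE = λ { (_⊎_.inj₁ s) → _⊎_.inj₂ s ; (_⊎_.inj₂ s) → _⊎_.inj₁ s }
  ; irrefE = irr }
  where
  irrS : ∀ {u} → Step G n u u → ⊥
  irrS (orig-orig (x , y , x<y , _) _) = <-irrefl-local x<y
    where
    <-irrefl-local : ∀ {a} → a < a → ⊥
    <-irrefl-local (Data.Nat.s≤s p) = <-irrefl-local p
  irrS (in-in e i .i j≡si) = n≢sn j≡si
    where
    n≢sn : ∀ {a} → a ≡ suc a → ⊥
    n≢sn ()
  irr : ∀ {u} → SubE G n u u → ⊥
  irr (_⊎_.inj₁ s) = irrS s
  irr (_⊎_.inj₂ s) = irrS s

FracPowE : (G : FinGraph) (m n : ℕ) → SubV G n → SubV G n → Set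
FracPowE G m n = PowE (Subdivision G n) m

-- For m < n the functions δ c (distance from an original vertex c) and σ p (distance from
-- an arbitrary vertex p), truncated at n, change by at most one along each subdivided edge,
-- so they bound distances in the subdivision from below.  Hence a clique of G^{m/n} never
-- contains two vertices lying near only the one and only the other end of the edge of a
-- third member: the three walks of length at most m among them would cut three paths of
-- length n into pieces whose crossing sums are all below n.  So the clique lies in the
-- star of one original vertex c.  A member of it is determined by its branch (the other
-- end of its edge) and its distance from c, and two members on different branches have
-- distances summing to at most m.  On a single branch the distances are distinct modulo
-- m + 1; on several branches an injection into 1 + Δ⌊m/2⌋ + (m mod 2) slots bounds the
-- clique.  Conversely, m + 1 consecutive vertices on one subdivided edge, and the vertices
-- within distance ⌊m/2⌋ of a vertex of maximum degree (plus one at distance ⌈m/2⌉ when m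
-- is odd) form cliques of these sizes.

module Submission where

open import Defs
open import Data.Nat using (ℕ; zero; suc; _+_; _*_; _∸_; _≤_; _<_; _⊓_; _⊔_; z≤n; s≤s; ∣_-_∣; _<?_; _≤?_; _/_; _%_; >-nonZero)
open import Data.Nat.Properties
open import Data.Nat.DivMod using (m≡m%n+[m/n]*n; m%n<n; m<n⇒m%n≡m; m*n/n≡m)
open import Data.Nat.ListAction using (sum)
open import Data.Fin as F using (Fin; toℕ; fromℕ<)
import Data.Fin.Properties as FP
open import Data.Bool using (true; false; if_then_else_)
import Data.Bool.Properties as BP
open import Data.Product hiding (map)
open import Data.Sum hiding (map)
open import Data.Empty
open import Data.Unit using (⊤; tt)
open import Function using (_∘_)
open import Relation.Nullary
open import Relation.Nullary.Decidable using (_×-dec_; ¬?)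
open import Relation.Binary.Definitions using (Symmetric; Tri; tri<; tri≈; tri>)
open import Relation.Binary.PropositionalEquality hiding ([_])
open import Axiom.UniquenessOfIdentityProofs using (module Decidable⇒UIP)
open import Data.List using (List; []; _∷_; length; filter; map; allFin; upTo; _++_)
open import Data.List.Properties using (filter-accept; filter-reject; filter-all; length-map; length-upTo; length-++; foldr-preservesᵒ)
open import Data.List.Relation.Unary.All as All using (All; []; _∷_)
import Data.List.Relation.Unary.All.Properties as AllP
open import Data.List.Relation.Unary.Any as Any using (Any; here; there; any?)
open import Data.List.Relation.Unary.AllPairs as AP using (AllPairs; []; _∷_)
import Data.List.Relation.Unary.AllPairs.Properties as APP
open import Data.List.Relation.Unary.Unique.Propositional using (Unique)
import Data.List.Relation.Unary.Unique.Propositional.Properties as UP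
open import Data.List.Membership.Propositional using (_∈_; find)
open import Data.List.Membership.Propositional.Properties
  using (∈-filter⁺; ∈-filter⁻; ∈-allFin; ∈-map⁺; ∈-map⁻; ∈-upTo⁻; ∈-++⁻; foldr-selective)

Near : ℕ → ℕ → Set
Near a b = a ≤ suc b × b ≤ suc a

near-refl : ∀ a → Near a a
near-refl a = n≤1+n a , n≤1+n a

near-sym : ∀ {a b} → Near a b → Near b a
near-sym (p , q) = q , p

near-suc : ∀ a → Near a (suc a)
near-suc a = ≤-trans (n≤1+n a) (n≤1+n _) , ≤-refl

near-≤1 : ∀ {a b} → a ≤ 1 → b ≤ 1 → Near a b
near-≤1 p q = ≤-trans p (s≤s z≤n) , ≤-trans q (s≤s z≤n)

near-+ˡ : ∀ k {a b} → Near a b → Near (k + a) (k + b)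
near-+ˡ k {a} {b} (p , q) =
  subst (k + a ≤_) (+-suc k b) (+-monoʳ-≤ k p) , subst (k + b ≤_) (+-suc k a) (+-monoʳ-≤ k q)

near-⊓ : ∀ {a b a' b'} → Near a b → Near a' b' → Near (a ⊓ a') (b ⊓ b')
near-⊓ (p , q) (p' , q') = ⊓-mono-≤ p p' , ⊓-mono-≤ q q'

near-∸ : ∀ n p → Near (n ∸ p) (n ∸ suc p)
near-∸ n p = n∸p≤1+n∸1+p n p , ≤-trans (∸-monoʳ-≤ n (n≤1+n p)) (n≤1+n _)
  where
  n∸p≤1+n∸1+p : ∀ n p → n ∸ p ≤ suc (n ∸ suc p)
  n∸p≤1+n∸1+p zero p = subst (_≤ 1) (sym (0∸n≡0 p)) z≤n
  n∸p≤1+n∸1+p (suc n) zero = ≤-refl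
  n∸p≤1+n∸1+p (suc n) (suc p) = n∸p≤1+n∸1+p n p

near-∣-∣ : ∀ a p → Near ∣ a - p ∣ ∣ a - suc p ∣
near-∣-∣ zero p = near-suc p
near-∣-∣ (suc a) zero = subst (Near (suc a)) (sym (∣-∣-identityʳ a)) (near-sym (near-suc a))
near-∣-∣ (suc a) (suc p) = near-∣-∣ a p

near-∣-pred∣ : ∀ n a → a < n → Near ∣ a - (n ∸ 1) ∣ (n ∸ a)
near-∣-pred∣ (suc n) a a<n =
  subst (λ t → Near t (suc n ∸ a)) (sym (m≤n⇒∣m-n∣≡n∸m (≤-pred a<n)))
    (subst (Near (n ∸ a)) (sym (+-∸-assoc 1 (≤-pred a<n))) (near-suc (n ∸ a)))

n∸[n∸1]≤1 : ∀ n → n ∸ (n ∸ 1) ≤ 1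
n∸[n∸1]≤1 zero = z≤n
n∸[n∸1]≤1 (suc n) = subst (_≤ 1) (sym (m+n∸n≡m 1 n)) ≤-refl

n≤1+[n∸1] : ∀ n → n ≤ suc (n ∸ 1)
n≤1+[n∸1] zero = z≤n
n≤1+[n∸1] (suc n) = ≤-refl

1+m≤n∸1⇒1+m<n : ∀ {m} n → suc m ≤ n ∸ 1 → suc m < n
1+m≤n∸1⇒1+m<n (suc n) 1+m≤n = s≤s 1+m≤n

∣1+n-[n∸q]∣≡1+q : ∀ n q → q ≤ n → ∣ suc n - (n ∸ q) ∣ ≡ suc q
∣1+n-[n∸q]∣≡1+q n q q≤n = trans (m≤n⇒∣n-m∣≡n∸m (≤-trans (m∸n≤m n q) (n≤1+n n)))
  (trans (+-∸-assoc 1 (m∸n≤m n q)) (cong suc (m∸[m∸n]≡n q≤n)))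

∣[n∸p]-[n∸q]∣≡∣p-q∣ : ∀ n p q → p ≤ n → q ≤ n → ∣ (n ∸ p) - (n ∸ q) ∣ ≡ ∣ p - q ∣
∣[n∸p]-[n∸q]∣≡∣p-q∣ n zero zero _ _ = ∣n-n∣≡0 n
∣[n∸p]-[n∸q]∣≡∣p-q∣ (suc n) (suc p) (suc q) (s≤s p≤n) (s≤s q≤n) = ∣[n∸p]-[n∸q]∣≡∣p-q∣ n p q p≤n q≤n
∣[n∸p]-[n∸q]∣≡∣p-q∣ (suc n) zero (suc q) _ (s≤s q≤n) = ∣1+n-[n∸q]∣≡1+q n q q≤n
∣[n∸p]-[n∸q]∣≡∣p-q∣ (suc n) (suc p) zero (s≤s p≤n) _ =
  trans (∣-∣-comm (n ∸ p) (suc n)) (∣1+n-[n∸q]∣≡1+q n p p≤n)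

-- Three splittings of n whose "crossing" sums are all below n cannot coexist:
-- they would give c < b < f < c.
no-short-splitting-triangle : ∀ {m n a b c d e f} → m < n →
  a + b ≡ n → c + d ≡ n → e + f ≡ n → a + c ≤ m → b + e ≤ m → d + f ≤ m → ⊥
no-short-splitting-triangle {m} {n} {a} {b} {c} {d} {e} {f} m<n ab cd ef ac be df =
  <-asym c<b (<-trans b<f f<c)
  where
  c<b : c < b
  c<b = +-cancelˡ-< a c b (subst (a + c <_) (sym ab) (≤-<-trans ac m<n))
  b<f : b < f
  b<f = +-cancelʳ-< e b f (subst (b + e <_) (trans (sym ef) (+-comm e f)) (≤-<-trans be m<n))
  f<c : f < c
  f<c = +-cancelˡ-< d f c (subst (d + f <_) (trans (sym cd) (+-comm c d)) (≤-<-trans df m<n))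

*+-injective : ∀ h {t t' a a'} → a < h → a' < h → t * h + a ≡ t' * h + a' → t ≡ t' × a ≡ a'
*+-injective h {zero} {zero} _ _ e = refl , e
*+-injective h {zero} {suc t'} {a} {a'} a<h _ e =
  ⊥-elim (<-irrefl e (<-≤-trans a<h (≤-trans (m≤m+n h (t' * h)) (m≤m+n _ a'))))
*+-injective h {suc t} {zero} {a} {a'} _ a'<h e =
  ⊥-elim (<-irrefl (sym e) (<-≤-trans a'<h (≤-trans (m≤m+n h (t * h)) (m≤m+n _ a))))
*+-injective h {suc t} {suc t'} {a} {a'} a<h a'<h e
  with *+-injective h {t} {t'} a<h a'<h (+-cancelˡ-≡ h _ _ (trans (sym (+-assoc h (t * h) a)) (trans e (+-assoc h (t' * h) a'))))
... | refl , a≡a' = refl , a≡a'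

*+-< : ∀ h {t D a} → t < D → a < h → t * h + a < D * h
*+-< h {t} {D} t<D a<h = <-≤-trans (+-monoʳ-< (t * h) a<h) (subst (_≤ D * h) (+-comm h (t * h)) (*-monoˡ-≤ h t<D))

≤-≡-mod-suc⇒≡ : ∀ m {a b} → a ≤ b → b ≤ a + m → a % suc m ≡ b % suc m → a ≡ b
≤-≡-mod-suc⇒≡ m {a} {b} a≤b b≤a+m e = by-quotients (<-cmp (a / M) (b / M))
  where
  M = suc m
  ea : a ≡ a % M + (a / M) * M
  ea = m≡m%n+[m/n]*n a M
  eb : b ≡ a % M + (b / M) * M
  eb = trans (m≡m%n+[m/n]*n b M) (cong (_+ (b / M) * M) (sym e))
  next-block : ∀ {s t} → s < t → a % M + s * M + M ≤ a % M + t * M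
  next-block {s} {t} s<t =
    ≤-trans (≤-reflexive (+-assoc (a % M) (s * M) M))
      (+-monoʳ-≤ (a % M) (subst (_≤ t * M) (+-comm M (s * M)) (*-monoˡ-≤ M s<t)))
  by-quotients : Tri (a / M < b / M) (a / M ≡ b / M) (b / M < a / M) → a ≡ b
  by-quotients (tri≈ _ q _) = trans ea (trans (cong (λ t → a % M + t * M) q) (sym eb))
  by-quotients (tri< q _ _) =
    ⊥-elim (<-irrefl refl (<-≤-trans (s≤s b≤a+m)
      (subst (_≤ b) (trans (cong (_+ M) (sym ea)) (+-suc a m)) (subst (a % M + (a / M) * M + M ≤_) (sym eb) (next-block q)))))
  by-quotients (tri> _ _ q) =
    ⊥-elim (<-irrefl refl (<-≤-trans (s≤s a≤b)
      (≤-trans (m<m+n b (s≤s z≤n)) (subst (_≤ a) (cong (_+ M) (sym eb))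
        (subst (a % M + (b / M) * M + M ≤_) (sym ea) (next-block q))))))

≤∧∣m-n∣≤o⇒n≤m+o : ∀ {m n o} → m ≤ n → ∣ m - n ∣ ≤ o → n ≤ m + o
≤∧∣m-n∣≤o⇒n≤m+o {m} {n} {o} m≤n ∣m-n∣≤o =
  subst (_≤ m + o) (m+[n∸m]≡n m≤n) (+-monoʳ-≤ m (subst (_≤ o) (m≤n⇒∣m-n∣≡n∸m m≤n) ∣m-n∣≤o))

≡-mod-suc⇒≡ : ∀ m {a b} → ∣ a - b ∣ ≤ m → a % suc m ≡ b % suc m → a ≡ b
≡-mod-suc⇒≡ m {a} {b} ∣a-b∣≤m a≡b with ≤-total a b
... | inj₁ a≤b = ≤-≡-mod-suc⇒≡ m a≤b (≤∧∣m-n∣≤o⇒n≤m+o a≤b ∣a-b∣≤m) a≡b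
... | inj₂ b≤a =
  sym (≤-≡-mod-suc⇒≡ m b≤a (≤∧∣m-n∣≤o⇒n≤m+o b≤a (subst (_≤ m) (∣-∣-comm a b) ∣a-b∣≤m)) (sym a≡b))

AllPairs-lookup : ∀ {A : Set} {R : A → A → Set} → Symmetric R → ∀ {xs} → AllPairs R xs →
                  ∀ {a b} → a ∈ xs → b ∈ xs → a ≢ b → R a b
AllPairs-lookup sym-R (_ ∷ _) (here refl) (here refl) a≢b = ⊥-elim (a≢b refl)
AllPairs-lookup sym-R (a∼ ∷ _) (here refl) (there b∈) _ = All.lookup a∼ b∈
AllPairs-lookup sym-R (b∼ ∷ _) (there a∈) (here refl) _ = sym-R (All.lookup b∼ a∈)
AllPairs-lookup sym-R (_ ∷ rest) (there a∈) (there b∈) a≢b = AllPairs-lookup sym-R rest a∈ b∈ a≢b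

AllPairs-tabulate : ∀ {A : Set} {R : A → A → Set} {xs : List A} → Unique xs →
                    (∀ {a b} → a ∈ xs → b ∈ xs → a ≢ b → R a b) → AllPairs R xs
AllPairs-tabulate [] _ = []
AllPairs-tabulate (x≢ ∷ rest) R-∈ =
  All.tabulate (λ b∈ → R-∈ (here refl) (there b∈) (All.lookup x≢ b∈)) ∷
  AllPairs-tabulate rest (λ a∈ b∈ → R-∈ (there a∈) (there b∈))

AllPairs-map-∈ : ∀ {A : Set} {R S : A → A → Set} {xs : List A} → AllPairs R xs →
                 (∀ {a b} → a ∈ xs → b ∈ xs → R a b → S a b) → AllPairs S xs
AllPairs-map-∈ [] _ = []
AllPairs-map-∈ (x∼ ∷ rest) R⇒S =
  All.tabulate (λ b∈ → R⇒S (here refl) (there b∈) (All.lookup x∼ b∈)) ∷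
  AllPairs-map-∈ rest (λ a∈ b∈ → R⇒S (there a∈) (there b∈))

Unique-map⁺-∈ : ∀ {A B : Set} (f : A → B) {xs : List A} → Unique xs →
                (∀ {a b} → a ∈ xs → b ∈ xs → f a ≡ f b → a ≡ b) → Unique (map f xs)
Unique-map⁺-∈ f u inj = APP.map⁺ (AllPairs-map-∈ u (λ a∈ b∈ a≢b fa≡fb → a≢b (inj a∈ b∈ fa≡fb)))

length≤1+length-filter : ∀ N {xs : List ℕ} → Unique xs → All (_< suc N) xs →
                         length xs ≤ suc (length (filter (_<? N) xs))
length≤1+length-filter N {[]} _ _ = z≤n
length≤1+length-filter N {x ∷ xs} (x≢ ∷ u) (x<1+N ∷ xs<1+N) with x <? N
... | yes x<N rewrite filter-accept (_<? N) {x} {xs} x<N = s≤s (length≤1+length-filter N u xs<1+N)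
... | no x≮N =
  subst (λ l → suc (length xs) ≤ suc (length l))
    (sym (trans (filter-reject (_<? N) {x} {xs} x≮N) (filter-all (_<? N) {xs} xs<N))) ≤-refl
  where
  x≡N : x ≡ N
  x≡N = ≤-antisym (≤-pred x<1+N) (≮⇒≥ x≮N)
  xs<N : All (_< N) xs
  xs<N = All.zipWith (λ (x≢y , y<1+N) → ≤∧≢⇒< (≤-pred y<1+N) (λ y≡N → x≢y (trans x≡N (sym y≡N)))) (x≢ , xs<1+N)

length-unique-< : ∀ N {xs : List ℕ} → Unique xs → All (_< N) xs → length xs ≤ N
length-unique-< zero {[]} _ _ = z≤n
length-unique-< zero {_ ∷ _} _ (() ∷ _)
length-unique-< (suc N) {xs} u xs<1+N =
  ≤-trans (length≤1+length-filter N u xs<1+N)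
    (s≤s (length-unique-< N (UP.filter⁺ (_<? N) u) (AllP.all-filter (_<? N) xs)))

pigeonhole : ∀ {A : Set} {R : A → A → Set} (f : A → ℕ) N {xs : List A} → AllPairs R xs →
             (∀ {a b} → a ∈ xs → b ∈ xs → R a b → f a ≢ f b) → (∀ {a} → a ∈ xs → f a < N) → length xs ≤ N
pigeonhole f N {xs} ap separated bounded =
  subst (_≤ N) (length-map f xs)
    (length-unique-< N (APP.map⁺ (AllPairs-map-∈ ap separated)) (AllP.map⁺ (All.tabulate bounded)))

module Neighbourhood (G : FinGraph) where
  open FinGraph G using (k; adj)

  adj? : (c u : Fin k) → Dec (adj c u ≡ true)
  adj? c u = adj c u BP.≟ true

  neighbours : Fin k → List (Fin k)
  neighbours c = filter (adj? c) (allFin k)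

  length-filter-adj : ∀ c (xs : List (Fin k)) →
                      length (filter (adj? c) xs) ≡ sum (map (λ y → if adj c y then 1 else 0) xs)
  length-filter-adj c [] = refl
  length-filter-adj c (x ∷ xs) with adj c x
  ... | true = cong suc (length-filter-adj c xs)
  ... | false = length-filter-adj c xs

  length-neighbours : ∀ c → length (neighbours c) ≡ degree G c
  length-neighbours c = length-filter-adj c (allFin k)

  ∈-neighbours⁺ : ∀ {c u} → adj c u ≡ true → u ∈ neighbours c
  ∈-neighbours⁺ {c} {u} a = ∈-filter⁺ (adj? c) (∈-allFin u) a

  ∈-neighbours⁻ : ∀ {c u} → u ∈ neighbours c → adj c u ≡ true
  ∈-neighbours⁻ {c} u∈ = proj₂ (∈-filter⁻ (adj? c) {xs = allFin k} u∈)

  neighbours-unique : ∀ c → Unique (neighbours c)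
  neighbours-unique c = UP.filter⁺ (adj? c) (UP.allFin⁺ k)

  neighbour-of-degree≥1 : ∀ c → 1 ≤ degree G c → ∃ λ u → u ∈ neighbours c
  neighbour-of-degree≥1 c 1≤deg with neighbours c | length-neighbours c
  ... | u ∷ _ | _ = u , here refl
  ... | [] | deg≡0 = ⊥-elim (<-irrefl deg≡0 1≤deg)

  index : Fin k → List (Fin k) → ℕ
  index u [] = 0
  index u (v ∷ vs) with u F.≟ v
  ... | yes _ = 0
  ... | no _ = suc (index u vs)

  index<length : ∀ {u vs} → u ∈ vs → index u vs < length vs
  index<length {u} {v ∷ vs} u∈ with u F.≟ v
  ... | yes _ = s≤s z≤n
  index<length {u} {v ∷ vs} (here u≡v) | no u≢v = ⊥-elim (u≢v u≡v)
  index<length {u} {v ∷ vs} (there u∈) | no _ = s≤s (index<length u∈)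

  index-injective : ∀ {u u' vs} → u ∈ vs → u' ∈ vs → index u vs ≡ index u' vs → u ≡ u'
  index-injective {u} {u'} {v ∷ vs} u∈ u'∈ e with u F.≟ v | u' F.≟ v
  ... | yes u≡v | yes u'≡v = trans u≡v (sym u'≡v)
  ... | yes _ | no _ = ⊥-elim (0≢1+n e)
  ... | no _ | yes _ = ⊥-elim (0≢1+n (sym e))
  index-injective (here u≡v) _ _ | no u≢v | no _ = ⊥-elim (u≢v u≡v)
  index-injective (there _) (here u'≡v) _ | no _ | no u'≢v = ⊥-elim (u'≢v u'≡v)
  index-injective (there u∈) (there u'∈) e | no _ | no _ = index-injective u∈ u'∈ (suc-injective e)

  degree≤Δ : ∀ c → degree G c ≤ Δ G
  degree≤Δ c = foldr-preservesᵒ {P = degree G c ≤_} {f = _⊔_} 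
    (λ x y → [ (λ d≤x → m≤n⇒m≤n⊔o y d≤x) , (λ d≤y → m≤n⇒m≤o⊔n x d≤y) ])
    0 (map (degree G) (allFin k)) (inj₂ (Any.map (λ { refl → ≤-refl }) (∈-map⁺ (degree G) (∈-allFin c))))

  Δ-attained : 1 ≤ Δ G → ∃ λ c → degree G c ≡ Δ G
  Δ-attained 1≤Δ with foldr-selective ⊔-sel 0 (map (degree G) (allFin k))
  ... | inj₁ Δ≡0 = ⊥-elim (<-irrefl (sym Δ≡0) 1≤Δ)
  ... | inj₂ Δ∈ with ∈-map⁻ (degree G) Δ∈
  ...   | c , _ , e = c , sym e

  Δ-attained-with-neighbour : 1 ≤ Δ G → ∃ λ c → degree G c ≡ Δ G × ∃ λ u → u ∈ neighbours c
  Δ-attained-with-neighbour 1≤Δ with Δ-attained 1≤Δ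
  ... | c , deg≡Δ = c , deg≡Δ , neighbour-of-degree≥1 c (subst (1 ≤_) (sym deg≡Δ) 1≤Δ)

  degree≤1⇒neighbour-unique : ∀ {c u u'} → degree G c ≤ 1 → u ∈ neighbours c → u' ∈ neighbours c → u ≡ u'
  degree≤1⇒neighbour-unique {c} deg≤1 = go (subst (_≤ 1) (sym (length-neighbours c)) deg≤1)
    where
    go : ∀ {u u' vs} → length vs ≤ 1 → u ∈ vs → u' ∈ vs → u ≡ u'
    go {vs = v ∷ []} _ (here u≡v) (here u'≡v) = trans u≡v (sym u'≡v)
    go {vs = v ∷ w ∷ vs} (s≤s ()) _ _

-- Truncated distances in the subdivision

module Distance (G : FinGraph) (n : ℕ) where
  open FinGraph G using (k)

  Vertex : Set
  Vertex = SubV G n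

  Sub : Graph
  Sub = Subdivision G n

  pos : Fin (n ∸ 1) → ℕ
  pos i = suc (toℕ i)

  pos<n : ∀ i → pos i < n
  pos<n i = 1+m≤n∸1⇒1+m<n n (FP.toℕ<n i)

  pos≤n : ∀ i → pos i ≤ n
  pos≤n i = <⇒≤ (pos<n i)

  δ-original : ∀ {A : Set} → Dec A → ℕ
  δ-original (yes _) = 0
  δ-original (no _) = n

  δ-internal : ∀ {A B : Set} → Dec A → Dec B → ℕ → ℕ
  δ-internal (yes _) _ p = p
  δ-internal (no _) (yes _) p = n ∸ p
  δ-internal (no _) (no _) _ = n

  -- δ c q is d(c, q) when q is c or lies on an edge at c, and n otherwise.
  δ : Fin k → Vertex → ℕ
  δ c (inj₁ u) = δ-original (u F.≟ c)
  δ c (inj₂ ((z , w , _ , _) , i)) = δ-internal (z F.≟ c) (w F.≟ c) (pos i)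

  via-ends : Fin k → Fin k → ℕ → Vertex → ℕ
  via-ends x y a q = n ⊓ (a + δ x q) ⊓ (n ∸ a + δ y q)

  on-edge : ∀ {A B : Set} → Dec A → Dec B → ℕ → ℕ → ℕ
  on-edge (yes _) (yes _) along _ = along
  on-edge (yes _) (no _) _ around = around
  on-edge (no _) _ _ around = around

  σ-internal : Fin k → Fin k → ℕ → Vertex → ℕ
  σ-internal x y a (inj₁ u) = via-ends x y a (inj₁ u)
  σ-internal x y a q@(inj₂ ((z , w , _ , _) , j)) = on-edge (z F.≟ x) (w F.≟ y) ∣ a - pos j ∣ (via-ends x y a q)

  -- σ p q ≤ d(p, q) (see PowE⇒Close), truncated at n: a walk from the vertex at position a
  -- on the edge xy either stays on that edge or leaves it through x or through y.
  σ : Vertex → Vertex → ℕ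
  σ (inj₁ c) q = δ c q
  σ (inj₂ ((x , y , _ , _) , i)) q = σ-internal x y (pos i) q

  Lipschitz : (Vertex → ℕ) → Set
  Lipschitz f = ∀ {u v} → Step G n u v → Near (f u) (f v)

  lipschitz-walk : ∀ {f} → Lipschitz f → ∀ {x y l} → Walk Sub x y l → f x ≤ l + f y × f y ≤ l + f x
  lipschitz-walk L nil = ≤-refl , ≤-refl
  lipschitz-walk {f} L (cons {x} {y} {z} {l} e w) with lipschitz-walk L w | step-near e
    where
    step-near : SubE G n x y → Near (f x) (f y)
    step-near (inj₁ s) = L s
    step-near (inj₂ s) = near-sym (L s)
  ... | fy≤ , fz≤ | fx≤1+fy , fy≤1+fx =
    ≤-trans fx≤1+fy (s≤s fy≤) ,
    ≤-trans fz≤ (subst (l + f y ≤_) (+-suc l (f x)) (+-monoʳ-≤ l fy≤1+fx))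

  δ-original≤n : ∀ {A : Set} (d : Dec A) → δ-original d ≤ n
  δ-original≤n (yes _) = z≤n
  δ-original≤n (no _) = ≤-refl

  δ-internal-near : ∀ {A B : Set} (d₁ : Dec A) (d₂ : Dec B) p → Near (δ-internal d₁ d₂ p) (δ-internal d₁ d₂ (suc p))
  δ-internal-near (yes _) _ p = near-suc p
  δ-internal-near (no _) (yes _) p = near-∸ n p
  δ-internal-near (no _) (no _) p = near-refl n

  δ-lipschitz : ∀ c → Lipschitz (δ c)
  δ-lipschitz c (orig-orig (z , w , _ , _) n≡1) =
    near-≤1 (subst (δ-original (z F.≟ c) ≤_) n≡1 (δ-original≤n (z F.≟ c)))
            (subst (δ-original (w F.≟ c) ≤_) n≡1 (δ-original≤n (w F.≟ c)))
  δ-lipschitz c (orig-in (z , w , _ , _) i i≡0) with z F.≟ c | w F.≟ c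
  ... | yes _ | _ = z≤n , s≤s (subst (_≤ 0) (sym i≡0) ≤-refl)
  ... | no _ | yes _ =
    subst (λ t → n ≤ suc (n ∸ t)) (cong suc (sym i≡0)) (n≤1+[n∸1] n) , ≤-trans (m∸n≤m n (pos i)) (n≤1+n n)
  ... | no _ | no _ = near-refl n
  δ-lipschitz c (in-in (z , w , _ , _) i j j≡1+i) =
    subst (λ t → Near (δ-internal (z F.≟ c) (w F.≟ c) (pos i)) (δ-internal (z F.≟ c) (w F.≟ c) t))
      (cong suc (sym j≡1+i)) (δ-internal-near (z F.≟ c) (w F.≟ c) (pos i))
  δ-lipschitz c (in-orig (z , w , z<w , _) i 1+i≡n∸1) with z F.≟ c | w F.≟ c
  ... | yes refl | yes refl = ⊥-elim (<-irrefl refl z<w)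
  ... | yes _ | no _ = subst (λ t → Near t n) (sym 1+i≡n∸1) (≤-trans (m∸n≤m n 1) (n≤1+n n) , n≤1+[n∸1] n)
  ... | no _ | yes _ = subst (λ t → Near (n ∸ t) 0) (sym 1+i≡n∸1) (n∸[n∸1]≤1 n , z≤n)
  ... | no _ | no _ = near-refl n

  via-ends-lipschitz : ∀ x y a → Lipschitz (via-ends x y a)
  via-ends-lipschitz x y a s =
    near-⊓ (near-⊓ (near-refl n) (near-+ˡ a (δ-lipschitz x s))) (near-+ˡ (n ∸ a) (δ-lipschitz y s))

  δ-refl : ∀ c → δ c (inj₁ c) ≡ 0
  δ-refl c with c F.≟ c
  ... | yes _ = refl
  ... | no c≢c = ⊥-elim (c≢c refl)

  δ-other : ∀ c u → u ≢ c → δ c (inj₁ u) ≡ n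
  δ-other c u u≢c with u F.≟ c
  ... | yes u≡c = ⊥-elim (u≢c u≡c)
  ... | no _ = refl

  <⇒≢ᶠ : ∀ {x y : Fin k} → toℕ x < toℕ y → x ≢ y
  <⇒≢ᶠ x<y refl = <-irrefl refl x<y

  via-ends-first : ∀ {x y} a → x ≢ y → a ≤ n → via-ends x y a (inj₁ x) ≡ a
  via-ends-first {x} {y} a x≢y a≤n rewrite δ-refl x | δ-other y x x≢y = begin
    n ⊓ (a + 0) ⊓ (n ∸ a + n)  ≡⟨ cong (λ t → n ⊓ t ⊓ (n ∸ a + n)) (+-identityʳ a) ⟩
    n ⊓ a ⊓ (n ∸ a + n)        ≡⟨ cong (_⊓ (n ∸ a + n)) (m≥n⇒m⊓n≡n a≤n) ⟩
    a ⊓ (n ∸ a + n)            ≡⟨ m≤n⇒m⊓n≡m (≤-trans a≤n (m≤n+m n (n ∸ a))) ⟩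
    a                          ∎
    where open ≡-Reasoning

  via-ends-second : ∀ {x y} a → x ≢ y → a ≤ n → via-ends x y a (inj₁ y) ≡ n ∸ a
  via-ends-second {x} {y} a x≢y a≤n rewrite δ-refl y | δ-other x y (x≢y ∘ sym) = begin
    n ⊓ (a + n) ⊓ (n ∸ a + 0)  ≡⟨ cong (n ⊓ (a + n) ⊓_) (+-identityʳ (n ∸ a)) ⟩
    n ⊓ (a + n) ⊓ (n ∸ a)      ≡⟨ cong (_⊓ (n ∸ a)) (m≤n⇒m⊓n≡m (m≤n+m n a)) ⟩
    n ⊓ (n ∸ a)                ≡⟨ m≥n⇒m⊓n≡n (m∸n≤m n a) ⟩
    n ∸ a                      ∎
    where open ≡-Reasoning

  on-edge-near : ∀ {A B : Set} (d₁ : Dec A) (d₂ : Dec B) {t along around} →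
                 Near t around → (A → B → Near t along) → Near t (on-edge d₁ d₂ along around)
  on-edge-near (yes a) (yes b) _ near-along = near-along a b
  on-edge-near (yes _) (no _) near-around _ = near-around
  on-edge-near (no _) _ near-around _ = near-around

  on-edge-near₂ : ∀ {A B : Set} (d₁ : Dec A) (d₂ : Dec B) {along around along' around'} →
                  Near around around' → Near along along' → Near (on-edge d₁ d₂ along around) (on-edge d₁ d₂ along' around')
  on-edge-near₂ (yes _) (yes _) _ near-along = near-along
  on-edge-near₂ (yes _) (no _) near-around _ = near-around
  on-edge-near₂ (no _) _ near-around _ = near-around

  σ-internal-lipschitz : ∀ x y a → toℕ x < toℕ y → 1 ≤ a → a < n → Lipschitz (σ-internal x y a)
  σ-internal-lipschitz x y a _ 1≤a a<n (orig-orig _ n≡1) =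
    ⊥-elim (<-irrefl refl (≤-trans (s≤s 1≤a) (subst (a <_) n≡1 a<n)))
  σ-internal-lipschitz x y a x<y 1≤a a<n s@(orig-in (z , w , _ , _) i i≡0) =
    on-edge-near (z F.≟ x) (w F.≟ y) (via-ends-lipschitz x y a s) λ { refl refl →
      subst (λ t → Near t ∣ a - pos i ∣) (sym (via-ends-first a (<⇒≢ᶠ x<y) (<⇒≤ a<n)))
        (subst (λ t → Near a ∣ a - suc t ∣) (sym i≡0) (near-pred a 1≤a)) }
    where
    near-pred : ∀ a → 1 ≤ a → Near a ∣ a - 1 ∣
    near-pred (suc a) _ = subst (Near (suc a)) (sym (∣-∣-identityʳ a)) (near-sym (near-suc a))
  σ-internal-lipschitz x y a _ _ _ s@(in-in (z , w , _ , _) i j j≡1+i) =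
    on-edge-near₂ (z F.≟ x) (w F.≟ y) (via-ends-lipschitz x y a s)
      (subst (λ t → Near ∣ a - pos i ∣ ∣ a - suc t ∣) (sym j≡1+i) (near-∣-∣ a (pos i)))
  σ-internal-lipschitz x y a x<y _ a<n s@(in-orig (z , w , _ , _) i 1+i≡n∸1) =
    near-sym (on-edge-near (z F.≟ x) (w F.≟ y) (near-sym (via-ends-lipschitz x y a s)) λ { refl refl →
      near-sym (subst (Near ∣ a - pos i ∣) (sym (via-ends-second a (<⇒≢ᶠ x<y) (<⇒≤ a<n)))
        (subst (λ t → Near ∣ a - t ∣ (n ∸ a)) (sym 1+i≡n∸1) (near-∣-pred∣ n a a<n))) })

  σ-lipschitz : ∀ p → Lipschitz (σ p)
  σ-lipschitz (inj₁ c) = δ-lipschitz c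
  σ-lipschitz (inj₂ ((x , y , x<y , _) , i)) = σ-internal-lipschitz x y (pos i) x<y (s≤s z≤n) (pos<n i)

  on-edge-along : ∀ {A B : Set} (d₁ : Dec A) (d₂ : Dec B) {along around} → A → B → on-edge d₁ d₂ along around ≡ along
  on-edge-along (yes _) (yes _) _ _ = refl
  on-edge-along (yes _) (no ¬b) _ b = ⊥-elim (¬b b)
  on-edge-along (no ¬a) _ a _ = ⊥-elim (¬a a)

  σ-same-edge : ∀ {x y x<y a i x<y' a' j} →
                σ (inj₂ ((x , y , x<y , a) , i)) (inj₂ ((x , y , x<y' , a') , j)) ≡ ∣ pos i - pos j ∣
  σ-same-edge {x} {y} = on-edge-along (x F.≟ x) (y F.≟ y) refl refl

  σ-refl : ∀ p → σ p p ≡ 0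
  σ-refl (inj₁ c) = δ-refl c
  σ-refl (inj₂ ((x , y , x<y , a) , i)) = trans (σ-same-edge {x} {y} {x<y} {a} {i} {x<y} {a} {i}) (∣n-n∣≡0 (pos i))

  Close : ℕ → Vertex → Vertex → Set
  Close m p q = p ≢ q × σ p q ≤ m × σ q p ≤ m

  Close-sym : ∀ {m} → Symmetric (Close m)
  Close-sym (p≢q , pq , qp) = p≢q ∘ sym , qp , pq

  PowE⇒Close : ∀ {m p q} → PowE Sub m p q → Close m p q
  PowE⇒Close {m} {p} {q} (p≢q , l , l≤m , w) =
    p≢q ,
    ≤-trans (proj₂ (lipschitz-walk (σ-lipschitz p) w)) (walk-bound (σ-refl p)) ,
    ≤-trans (proj₁ (lipschitz-walk (σ-lipschitz q) w)) (walk-bound (σ-refl q))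
    where
    walk-bound : ∀ {s} → s ≡ 0 → l + s ≤ m
    walk-bound refl = subst (_≤ m) (sym (+-identityʳ l)) l≤m

-- Vertices within distance n of an original vertex

module Star (G : FinGraph) (n : ℕ) where
  open FinGraph G using (k; adj) renaming (sym to adj-sym)
  open Distance G n

  Internal : Set
  Internal = EdgeOf G × Fin (n ∸ 1)

  data AtEnd (c : Fin k) : Internal → Set where
    first  : ∀ {w c<w a} j → AtEnd c ((c , w , c<w , a) , j)
    second : ∀ {z z<c a} j → AtEnd c ((z , c , z<c , a) , j)

  at-end : ∀ {c} e → δ c (inj₂ e) < n → AtEnd c e
  at-end {c} ((z , w , _ , _) , j) δ<n with z F.≟ c | w F.≟ c
  ... | yes refl | _ = first j
  ... | no _ | yes refl = second j
  ... | no _ | no _ = ⊥-elim (<-irrefl refl δ<n)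

  δ-original<n⇒≡ : ∀ {c u} → δ c (inj₁ u) < n → u ≡ c
  δ-original<n⇒≡ {c} {u} δ<n with u F.≟ c
  ... | yes u≡c = u≡c
  ... | no _ = ⊥-elim (<-irrefl refl δ<n)

  δ-first : ∀ e j → δ (proj₁ e) (inj₂ (e , j)) ≡ pos j
  δ-first (z , _) j with z F.≟ z
  ... | yes _ = refl
  ... | no z≢z = ⊥-elim (z≢z refl)

  δ-second : ∀ e j → δ (proj₁ (proj₂ e)) (inj₂ (e , j)) ≡ n ∸ pos j
  δ-second (z , w , z<w , _) j with z F.≟ w | w F.≟ w
  ... | yes z≡w | _ = ⊥-elim (<⇒≢ᶠ z<w z≡w)
  ... | no _ | yes _ = refl
  ... | no _ | no w≢w = ⊥-elim (w≢w refl)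

  δ-first<n : ∀ e j → δ (proj₁ e) (inj₂ (e , j)) < n
  δ-first<n e j = subst (_< n) (sym (δ-first e j)) (pos<n j)

  δ-second<n : ∀ e j → δ (proj₁ (proj₂ e)) (inj₂ (e , j)) < n
  δ-second<n e j = subst (_< n) (sym (δ-second e j)) (∸-monoʳ-< {n} (s≤s z≤n) (pos≤n j))

  δ-end≥1 : ∀ {c e} → AtEnd c e → 1 ≤ δ c (inj₂ e)
  δ-end≥1 {c} (first {w} {c<w} {a} j) = subst (1 ≤_) (sym (δ-first (c , w , c<w , a) j)) (s≤s z≤n)
  δ-end≥1 {c} (second {z} {z<c} {a} j) = subst (1 ≤_) (sym (δ-second (z , c , z<c , a) j)) (m<n⇒0<n∸m (pos<n j))

  other-end : ∀ {A : Set} → Dec A → Fin k → Fin k → Fin k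
  other-end (yes _) _ w = w
  other-end (no _) z _ = z

  opposite : Fin k → Internal → Fin k
  opposite c ((z , w , _ , _) , _) = other-end (z F.≟ c) z w

  opposite-first : ∀ e j → opposite (proj₁ e) (e , j) ≡ proj₁ (proj₂ e)
  opposite-first (z , _) j with z F.≟ z
  ... | yes _ = refl
  ... | no z≢z = ⊥-elim (z≢z refl)

  opposite-second : ∀ e j → opposite (proj₁ (proj₂ e)) (e , j) ≡ proj₁ e
  opposite-second (z , w , z<w , _) j with z F.≟ w
  ... | yes z≡w = ⊥-elim (<⇒≢ᶠ z<w z≡w)
  ... | no _ = refl

  opposite-adj : ∀ {c e} → AtEnd c e → adj c (opposite c e) ≡ true
  opposite-adj {c} (first {w} {c<w} {a} j) = subst (λ u → adj c u ≡ true) (sym (opposite-first (c , w , c<w , a) j)) a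
  opposite-adj {c} (second {z} {z<c} {a} j) =
    subst (λ u → adj c u ≡ true) (sym (opposite-second (z , c , z<c , a) j)) (trans (adj-sym c z) a)

  opposite≢ : ∀ {c e} → AtEnd c e → opposite c e ≢ c
  opposite≢ {c} (first {w} {c<w} {a} j) o≡c = <⇒≢ᶠ c<w (sym (trans (sym (opposite-first (c , w , c<w , a) j)) o≡c))
  opposite≢ {c} (second {z} {z<c} {a} j) o≡c = <⇒≢ᶠ z<c (trans (sym (opposite-second (z , c , z<c , a) j)) o≡c)

  opposite-at-end : ∀ {c e} → AtEnd c e → AtEnd (opposite c e) e
  opposite-at-end {c} (first {w} {c<w} {a} j) = subst (λ u → AtEnd u _) (sym (opposite-first (c , w , c<w , a) j)) (second j)
  opposite-at-end {c} (second {z} {z<c} {a} j) = subst (λ u → AtEnd u _) (sym (opposite-second (z , c , z<c , a) j)) (first j)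

  ends-are-c-and-opposite : ∀ {c u e} → AtEnd c e → AtEnd u e → u ≢ c → u ≡ opposite c e
  ends-are-c-and-opposite (first _) (first _) u≢c = ⊥-elim (u≢c refl)
  ends-are-c-and-opposite {c} (first {w} {c<w} {a} j) (second _) _ = sym (opposite-first (c , w , c<w , a) j)
  ends-are-c-and-opposite {c} (second {z} {z<c} {a} j) (first _) _ = sym (opposite-second (z , c , z<c , a) j)
  ends-are-c-and-opposite (second _) (second _) u≢c = ⊥-elim (u≢c refl)

  δ+δ-opposite≡n : ∀ {c e} → AtEnd c e → δ c (inj₂ e) + δ (opposite c e) (inj₂ e) ≡ n
  δ+δ-opposite≡n {c} (first {w} {c<w} {a} j) =
    trans (cong₂ _+_ (δ-first e j) (trans (cong (λ u → δ u (inj₂ (e , j))) (opposite-first e j)) (δ-second e j)))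
      (m+[n∸m]≡n (pos≤n j))
    where e = (c , w , c<w , a)
  δ+δ-opposite≡n {c} (second {z} {z<c} {a} j) =
    trans (cong₂ _+_ (δ-second e j) (trans (cong (λ u → δ u (inj₂ (e , j))) (opposite-second e j)) (δ-first e j)))
      (trans (+-comm (n ∸ pos j) (pos j)) (m+[n∸m]≡n (pos≤n j)))
    where e = (z , c , z<c , a)

  δ+δ≡n : ∀ {u u' e} → AtEnd u e → AtEnd u' e → u ≢ u' → δ u (inj₂ e) + δ u' (inj₂ e) ≡ n
  δ+δ≡n {u} {u'} {e} at-u at-u' u≢u' =
    subst (λ v → δ u (inj₂ e) + δ v (inj₂ e) ≡ n) (sym (ends-are-c-and-opposite at-u at-u' (u≢u' ∘ sym)))
      (δ+δ-opposite≡n at-u)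

  internal-≡ : ∀ {x y x<y x<y' a a'} {j j' : Fin (n ∸ 1)} → toℕ j ≡ toℕ j' →
               _≡_ {A = Internal} ((x , y , x<y , a) , j) ((x , y , x<y' , a') , j')
  internal-≡ {x<y = x<y} {x<y'} {a} {a'} j≡j'
    rewrite ≤-irrelevant x<y x<y' | Decidable⇒UIP.≡-irrelevant BP._≟_ a a' | FP.toℕ-injective j≡j' = refl

  first-end second-end : Internal → Fin k
  first-end ((x , _) , _) = x
  second-end ((_ , y , _) , _) = y

  OffEdge : Internal → Vertex → Set
  OffEdge _ (inj₁ _) = ⊤
  OffEdge e (inj₂ ((z , w , _) , _)) = ¬ (z ≡ first-end e × w ≡ second-end e)

  Via : ℕ → Fin k → Vertex → Vertex → Set
  Via m u p q = δ u p + δ u q ≤ m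

  via⇒δ<n : ∀ {m u p q} → m < n → Via m u p q → δ u q < n
  via⇒δ<n {p = p} {q} m<n via = ≤-<-trans (≤-trans (m≤n+m _ (δ _ p)) via) m<n

  σ-off-edge : ∀ e q → OffEdge e q → σ (inj₂ e) q ≡ via-ends (first-end e) (second-end e) (pos (proj₂ e)) q
  σ-off-edge _ (inj₁ _) _ = refl
  σ-off-edge ((x , y , _) , _) (inj₂ ((z , w , _) , _)) off with z F.≟ x | w F.≟ y
  ... | yes z≡x | yes w≡y = ⊥-elim (off (z≡x , w≡y))
  ... | yes _ | no _ = refl
  ... | no _ | _ = refl

  -- A path of length below n from an internal vertex has to leave its edge through an end.
  leave-edge : ∀ {m} → m < n → ∀ e q → OffEdge e q → σ (inj₂ e) q ≤ m →
               Via m (first-end e) (inj₂ e) q ⊎ Via m (second-end e) (inj₂ e) q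
  leave-edge {m} m<n e@(E@(x , y , _) , i) q off σ≤m
    with ⊓-sel (n ⊓ (pos i + δ x q)) (n ∸ pos i + δ y q) | ⊓-sel n (pos i + δ x q)
  ... | inj₂ via-y | _ =
    inj₂ (subst (λ t → t + δ y q ≤ m) (sym (δ-second E i)) (subst (_≤ m) (trans (σ-off-edge e q off) via-y) σ≤m))
  ... | inj₁ via-x | inj₂ x-route =
    inj₁ (subst (λ t → t + δ x q ≤ m) (sym (δ-first E i))
      (subst (_≤ m) (trans (σ-off-edge e q off) (trans via-x x-route)) σ≤m))
  ... | inj₁ via-x | inj₁ capped =
    ⊥-elim (<-irrefl refl (≤-<-trans (subst (_≤ m) (trans (σ-off-edge e q off) (trans via-x capped)) σ≤m) m<n))

  leave-edge-at : ∀ {m c e} → m < n → AtEnd c e → ∀ q → OffEdge e q → σ (inj₂ e) q ≤ m →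
                  Via m c (inj₂ e) q ⊎ Via m (opposite c e) (inj₂ e) q
  leave-edge-at {m} {c} m<n (first {w} {c<w} {a} j) q off σ≤m =
    Data.Sum.map₂ (subst (λ u → Via m u (inj₂ (E , j)) q) (sym (opposite-first E j))) (leave-edge m<n (E , j) q off σ≤m)
    where E = (c , w , c<w , a)
  leave-edge-at {m} {c} m<n (second {z} {z<c} {a} j) q off σ≤m =
    Data.Sum.swap (Data.Sum.map₁ (subst (λ u → Via m u (inj₂ (E , j)) q) (sym (opposite-second E j)))
      (leave-edge m<n (E , j) q off σ≤m))
    where E = (z , c , z<c , a)

  off-edge-of-far : ∀ {u} e q → (u ≡ first-end e ⊎ u ≡ second-end e) → ¬ (δ u q < n) → OffEdge e q
  off-edge-of-far e (inj₁ _) _ _ = tt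
  off-edge-of-far e (inj₂ (E , j)) (inj₁ refl) far (refl , refl) = far (δ-first<n E j)
  off-edge-of-far e (inj₂ (E , j)) (inj₂ refl) far (refl , refl) = far (δ-second<n E j)

  close-to-an-end : ∀ {m} → m < n → ∀ e q → σ (inj₂ e) q ≤ m → δ (first-end e) q < n ⊎ δ (second-end e) q < n
  close-to-an-end m<n e q σ≤m with δ (first-end e) q <? n
  ... | yes near-x = inj₁ near-x
  ... | no far-x = Data.Sum.map (via⇒δ<n {p = inj₂ e} {q} m<n) (via⇒δ<n {p = inj₂ e} {q} m<n)
                     (leave-edge m<n e q (off-edge-of-far e q (inj₁ refl) far-x) σ≤m)

  same-ends⇒same-opposite : ∀ {c} e e' → first-end e' ≡ first-end e × second-end e' ≡ second-end e →
                            opposite c e ≡ opposite c e'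
  same-ends⇒same-opposite _ _ (refl , refl) = refl

  Close-different-branches : ∀ {m c e e'} → m < n → AtEnd c e → AtEnd c e' → Close m (inj₂ e) (inj₂ e') →
                             opposite c e ≢ opposite c e' → Via m c (inj₂ e) (inj₂ e')
  Close-different-branches {m} {c} {e} {e'} m<n at at' (_ , σ≤m , _) o≢o'
    with leave-edge-at m<n at (inj₂ e') (o≢o' ∘ same-ends⇒same-opposite e e') σ≤m
  ... | inj₁ via-c = via-c
  ... | inj₂ via-o =
    ⊥-elim (o≢o' (ends-are-c-and-opposite at' (at-end e' (via⇒δ<n {p = inj₂ e} {inj₂ e'} m<n via-o)) (opposite≢ at)))

  same-branch : ∀ {c e e'} → AtEnd c e → AtEnd c e' → opposite c e ≡ opposite c e' →
                ∣ δ c (inj₂ e) - δ c (inj₂ e') ∣ ≡ σ (inj₂ e) (inj₂ e') ×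
                (δ c (inj₂ e) ≡ δ c (inj₂ e') → e ≡ e')
  same-branch {c} (first {w} {c<w} {a} j) (first {w'} {c<w'} {a'} j') o≡o'
    with trans (sym (opposite-first (c , w , c<w , a) j)) (trans o≡o' (opposite-first (c , w' , c<w' , a') j'))
  ... | refl =
    trans (cong₂ ∣_-_∣ (δ-first E j) (δ-first E' j')) (sym (σ-same-edge {c} {w} {c<w} {a} {j} {c<w'} {a'} {j'})) ,
    λ δ≡δ' → internal-≡ (suc-injective (trans (sym (δ-first E j)) (trans δ≡δ' (δ-first E' j'))))
    where
    E = (c , w , c<w , a)
    E' = (c , w , c<w' , a')
  same-branch {c} (second {z} {z<c} {a} j) (second {z'} {z'<c} {a'} j') o≡o'
    with trans (sym (opposite-second (z , c , z<c , a) j)) (trans o≡o' (opposite-second (z' , c , z'<c , a') j'))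
  ... | refl =
    trans (cong₂ ∣_-_∣ (δ-second E j) (δ-second E' j'))
      (trans (∣[n∸p]-[n∸q]∣≡∣p-q∣ n (pos j) (pos j') (pos≤n j) (pos≤n j'))
        (sym (σ-same-edge {z} {c} {z<c} {a} {j} {z'<c} {a'} {j'}))) ,
    λ δ≡δ' → internal-≡ (suc-injective (∸-cancelˡ-≡ (pos≤n j) (pos≤n j')
                (trans (sym (δ-second E j)) (trans δ≡δ' (δ-second E' j')))))
    where
    E = (z , c , z<c , a)
    E' = (z , c , z'<c , a')
  same-branch {c} (first {w} {c<w} {a} j) (second {z'} {z'<c} {a'} j') o≡o' =
    ⊥-elim (<-asym c<w (subst (λ u → toℕ u < toℕ c) (sym w≡z') z'<c))
    where
    w≡z' : w ≡ z'
    w≡z' = trans (sym (opposite-first (c , w , c<w , a) j)) (trans o≡o' (opposite-second (z' , c , z'<c , a') j'))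
  same-branch {c} (second {z} {z<c} {a} j) (first {w'} {c<w'} {a'} j') o≡o' =
    ⊥-elim (<-asym c<w' (subst (λ u → toℕ u < toℕ c) w≡z z<c))
    where
    w≡z : z ≡ w'
    w≡z = trans (sym (opposite-second (z , c , z<c , a) j)) (trans o≡o' (opposite-first (c , w' , c<w' , a') j'))

  δ-end<n : ∀ {c e} → AtEnd c e → δ c (inj₂ e) < n
  δ-end<n {c} (first {w} {c<w} {a} j) = δ-first<n (c , w , c<w , a) j
  δ-end<n {c} (second {z} {z<c} {a} j) = δ-second<n (z , c , z<c , a) j

  AtEnd⇒end : ∀ {c e} → AtEnd c e → c ≡ first-end e ⊎ c ≡ second-end e
  AtEnd⇒end (first _) = inj₁ refl
  AtEnd⇒end (second _) = inj₂ refl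

  -- p, r, q pairwise Close with r near only the first end x of p's edge and q near only
  -- the second end y: the routes p–r through x, p–q through y and r–q through the other
  -- end o of r's edge cut the three splittings of n at p, r and q too short.
  no-split-clique : ∀ {m} → m < n → ∀ e r q → δ (first-end e) r < n → ¬ δ (second-end e) r < n →
                    δ (second-end e) q < n → ¬ δ (first-end e) q < n →
                    Close m (inj₂ e) r → Close m (inj₂ e) q → Close m r q → ⊥
  no-split-clique {m} m<n e@((x , y , x<y , xy) , i) r q near-xr far-yr near-yq far-xq
                  (_ , σpr≤m , _) (_ , σpq≤m , _) (_ , σrq≤m , _)
    with leave-edge m<n e r (off-edge-of-far e r (inj₂ refl) far-yr) σpr≤m
       | leave-edge m<n e q (off-edge-of-far e q (inj₁ refl) far-xq) σpq≤m
  ... | inj₂ via-yr | _ = far-yr (via⇒δ<n {p = inj₂ e} {r} m<n via-yr)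
  ... | inj₁ _ | inj₁ via-xq = far-xq (via⇒δ<n {p = inj₂ e} {q} m<n via-xq)
  ... | inj₁ via-xr | inj₂ via-yq = through r near-xr far-yr σrq≤m via-xr
    where
    through : ∀ r → δ x r < n → ¬ δ y r < n → σ r q ≤ m → Via m x (inj₂ e) r → ⊥
    through (inj₁ u) near-xr _ σrq≤m _ with δ-original<n⇒≡ near-xr
    ... | refl = far-xq (≤-<-trans σrq≤m m<n)
    through (inj₂ f) near-xr far-yr σrq≤m via-xr
      with leave-edge-at m<n (at-end f near-xr) q (off-edge-of-far f q (AtEnd⇒end (at-end f near-xr)) far-xq) σrq≤m
    ... | inj₁ via-xq = far-xq (via⇒δ<n {p = inj₂ f} {q} m<n via-xq)
    ... | inj₂ via-oq = triangle q near-yq near-oq via-yq via-oq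
      where
      at-x = at-end f near-xr
      o = opposite x f
      near-oq : δ o q < n
      near-oq = via⇒δ<n {p = inj₂ f} {q} m<n via-oq
      o≢y : o ≢ y
      o≢y o≡y = far-yr (subst (λ u → δ u (inj₂ f) < n) o≡y (δ-end<n (opposite-at-end at-x)))
      triangle : ∀ q → δ y q < n → δ o q < n → Via m y (inj₂ e) q → Via m o (inj₂ f) q → ⊥
      triangle (inj₁ u) near-yq near-oq _ _ with δ-original<n⇒≡ near-yq | δ-original<n⇒≡ near-oq
      ... | refl | refl = o≢y refl
      triangle (inj₂ g) near-yq near-oq via-yq via-oq =
        no-short-splitting-triangle
          {a = δ x (inj₂ e)} {δ y (inj₂ e)} {δ x (inj₂ f)} {δ o (inj₂ f)} {δ y (inj₂ g)} {δ o (inj₂ g)} m<n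
          (δ+δ≡n (first {c<w = x<y} {xy} i) (second i) (<⇒≢ᶠ x<y))
          (δ+δ-opposite≡n at-x)
          (δ+δ≡n (at-end g near-yq) (at-end g near-oq) (o≢y ∘ sym))
          via-xr via-yq via-oq

  Close-or-self : ∀ {m p S q} → All (Close m p) S → q ∈ p ∷ S → q ≡ p ⊎ Close m p q
  Close-or-self _ (here q≡p) = inj₁ q≡p
  Close-or-self p∼S (there q∈S) = inj₂ (All.lookup p∼S q∈S)

  clique-centre : ∀ {m} → m < n → ∀ {p S} → AllPairs (Close m) (p ∷ S) → ∃ λ c → All (λ q → δ c q < n) (p ∷ S)
  clique-centre {m} m<n {inj₁ c} (p∼S ∷ _) = c , All.tabulate near
    where
    near : ∀ {q} → q ∈ inj₁ c ∷ _ → δ c q < n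
    near q∈ with Close-or-self p∼S q∈
    ... | inj₁ refl = subst (_< n) (sym (δ-refl c)) (≤-<-trans z≤n m<n)
    ... | inj₂ (_ , σ≤m , _) = ≤-<-trans σ≤m m<n
  clique-centre {m} m<n {p@(inj₂ e@(E@(x , y , _) , i))} {S} ap@(p∼S ∷ _)
    with any? (λ q → (δ x q <? n) ×-dec ¬? (δ y q <? n)) (p ∷ S)
  ... | yes x-only with find x-only
  ...   | r , r∈ , (near-xr , far-yr) = x , All.tabulate near
    where
    near : ∀ {q} → q ∈ p ∷ S → δ x q < n
    near {q} q∈ with δ x q <? n | Close-or-self p∼S q∈
    ... | yes near-xq | _ = near-xq
    ... | no far-xq | inj₁ refl = ⊥-elim (far-xq (δ-first<n E i))
    ... | no far-xq | inj₂ pq with close-to-an-end m<n e q (proj₁ (proj₂ pq))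
    ...   | inj₁ near-xq = ⊥-elim (far-xq near-xq)
    ...   | inj₂ near-yq with Close-or-self p∼S r∈
    ...     | inj₁ refl = ⊥-elim (far-yr (δ-second<n E i))
    ...     | inj₂ pr = ⊥-elim (no-split-clique m<n e r q near-xr far-yr near-yq far-xq pr pq
                          (AllPairs-lookup Close-sym ap r∈ q∈ (λ { refl → far-yr near-yq })))
  clique-centre {m} m<n {p@(inj₂ e@(E@(x , y , _) , i))} {S} (p∼S ∷ _) | no ¬x-only = y , All.tabulate near
    where
    near : ∀ {q} → q ∈ p ∷ S → δ y q < n
    near {q} q∈ with δ y q <? n | Close-or-self p∼S q∈
    ... | yes near-yq | _ = near-yq
    ... | no far-yq | inj₁ refl = ⊥-elim (far-yq (δ-second<n E i))
    ... | no far-yq | inj₂ pq with close-to-an-end m<n e q (proj₁ (proj₂ pq))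
    ...   | inj₁ near-xq = ⊥-elim (¬x-only (Any.map (λ { refl → near-xq , far-yq }) q∈))
    ...   | inj₂ near-yq = ⊥-elim (far-yq near-yq)

-- A vertex on branch t < D at distance d gets slot 1 + t h + (d - 1) if d ≤ h, the shared
-- slot 1 + D h if d = h + 1 (possible only for m odd), and otherwise the slot of distance
-- m + 1 - d ≤ h on the branch other-branch t ≠ t: a vertex at distance d on branch t rules
-- out all vertices at distance ≥ m + 1 - d on other branches.
module Slots (m h r D : ℕ) (m≡h+h+r : m ≡ h + h + r) (r≤1 : r ≤ 1) (2≤D : 2 ≤ D) where

  other-branch : ℕ → ℕ
  other-branch zero = 1
  other-branch (suc _) = 0

  other-branch≢ : ∀ t → other-branch t ≢ t
  other-branch≢ zero ()
  other-branch≢ (suc t) ()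

  other-branch<D : ∀ t → other-branch t < D
  other-branch<D zero = 2≤D
  other-branch<D (suc _) = ≤-trans (s≤s z≤n) 2≤D

  slot-by : ∀ (t d : ℕ) {A B : Set} → Dec A → Dec B → ℕ
  slot-by t d (yes _) _ = suc (t * h + (d ∸ 1))
  slot-by t d (no _) (yes _) = suc (D * h)
  slot-by t d (no _) (no _) = suc (other-branch t * h + (m ∸ d))

  slot : ℕ → ℕ → ℕ
  slot t d = slot-by t d (d ≤? h) (d ≤? h + r)

  data SlotCase (t d s : ℕ) : Set where
    own      : d ≤ h → s ≡ suc (t * h + (d ∸ 1)) → SlotCase t d s
    shared   : h < d → d ≤ h + r → s ≡ suc (D * h) → SlotCase t d s
    borrowed : h + r < d → s ≡ suc (other-branch t * h + (m ∸ d)) → SlotCase t d s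

  slot-case : ∀ t d → SlotCase t d (slot t d)
  slot-case t d = by (d ≤? h) (d ≤? h + r)
    where
    by : (a : Dec (d ≤ h)) (b : Dec (d ≤ h + r)) → SlotCase t d (slot-by t d a b)
    by (yes d≤h) _ = own d≤h refl
    by (no d≰h) (yes d≤h+r) = shared (≰⇒> d≰h) d≤h+r refl
    by (no _) (no d≰h+r) = borrowed (≰⇒> d≰h+r) refl

  slot≢0 : ∀ t d → slot t d ≢ 0
  slot≢0 t d with slot-case t d
  ... | own _ s≡ = λ s≡0 → 0≢1+n (trans (sym s≡0) s≡)
  ... | shared _ _ s≡ = λ s≡0 → 0≢1+n (trans (sym s≡0) s≡)
  ... | borrowed _ s≡ = λ s≡0 → 0≢1+n (trans (sym s≡0) s≡)

  d∸1<h : ∀ {d} → 1 ≤ d → d ≤ h → d ∸ 1 < h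
  d∸1<h {suc d} _ d≤h = d≤h

  m∸d<h : ∀ {d} → h + r < d → d ≤ m → m ∸ d < h
  m∸d<h {d} h+r<d d≤m =
    +-cancelʳ-< d (m ∸ d) h (subst (_< h + d) (sym (m∸n+n≡m d≤m))
      (subst (_< h + d) (sym (trans m≡h+h+r (+-assoc h h r))) (+-monoʳ-< h h+r<d)))

  slot≤ : ∀ t d → t < D → 1 ≤ d → d ≤ m → slot t d < suc (D * h + r)
  slot≤ t d t<D 1≤d d≤m with slot-case t d
  ... | own d≤h s≡ rewrite s≡ = s≤s (<-≤-trans (*+-< h t<D (d∸1<h 1≤d d≤h)) (m≤m+n (D * h) r))
  ... | shared h<d d≤h+r s≡ rewrite s≡ =
    s≤s (subst (_≤ D * h + r) (+-comm (D * h) 1)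
      (+-monoʳ-≤ (D * h) (+-cancelˡ-≤ h 1 r (subst (_≤ h + r) (sym (+-comm h 1)) (<-≤-trans h<d d≤h+r)))))
  ... | borrowed h+r<d s≡ rewrite s≡ =
    s≤s (<-≤-trans (*+-< h (other-branch<D t) (m∸d<h h+r<d d≤m)) (m≤m+n (D * h) r))

  Compatible : ℕ → ℕ → ℕ → ℕ → Set
  Compatible t d t' d' = t < D × t' < D × 1 ≤ d × d ≤ m × 1 ≤ d' × d' ≤ m × (t ≢ t' → d + d' ≤ m)

  Compatible-sym : ∀ {t d t' d'} → Compatible t d t' d' → Compatible t' d' t d
  Compatible-sym {t} {d} {t'} {d'} (t<D , t'<D , 1≤d , d≤m , 1≤d' , d'≤m , far) =
    t'<D , t<D , 1≤d' , d'≤m , 1≤d , d≤m , λ t'≢t → subst (_≤ m) (+-comm d d') (far (t'≢t ∘ sym))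

  beyond-half : ∀ {d d'} → h < d → h < d' → m < d + d'
  beyond-half {d} {d'} h<d h<d' =
    ≤-trans (s≤s (subst (_≤ suc (h + h)) (sym m≡h+h+r) (subst (h + h + r ≤_) (+-comm (h + h) 1) (+-monoʳ-≤ (h + h) r≤1))))
      (subst (_≤ d + d') (cong suc (+-suc h h)) (+-mono-≤ h<d h<d'))

  own≢shared : ∀ {t d} → t < D → 1 ≤ d → d ≤ h → suc (t * h + (d ∸ 1)) ≢ suc (D * h)
  own≢shared t<D 1≤d d≤h s≡s' = <-irrefl (suc-injective s≡s') (*+-< h t<D (d∸1<h 1≤d d≤h))

  shared≢borrowed : ∀ {t d} → h + r < d → d ≤ m → suc (D * h) ≢ suc (other-branch t * h + (m ∸ d))
  shared≢borrowed {t} h+r<d d≤m s≡s' =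
    <-irrefl (sym (suc-injective s≡s')) (*+-< h (other-branch<D t) (m∸d<h h+r<d d≤m))

  own≢borrowed : ∀ {t d t' d'} → Compatible t d t' d' → d ≤ h → h + r < d' →
                 suc (t * h + (d ∸ 1)) ≢ suc (other-branch t' * h + (m ∸ d'))
  own≢borrowed {t} {d} {t'} {d'} (_ , _ , 1≤d , _ , _ , d'≤m , far) d≤h h+r<d' s≡s'
    with *+-injective h {t} {other-branch t'} (d∸1<h 1≤d d≤h) (m∸d<h h+r<d' d'≤m) (suc-injective s≡s')
  ... | t≡ , d∸1≡m∸d' with t ≟ t'
  ...   | yes refl = other-branch≢ t (sym t≡)
  ...   | no t≢t' = <-irrefl (sum≡1+m 1≤d d∸1≡m∸d') (s≤s (far t≢t'))
    where
    sum≡1+m : ∀ {d} → 1 ≤ d → d ∸ 1 ≡ m ∸ d' → d + d' ≡ suc m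
    sum≡1+m {suc d} _ d≡m∸d' = cong suc (trans (cong (_+ d') d≡m∸d') (m∸n+n≡m d'≤m))

  own-injective : ∀ {t d t' d'} → 1 ≤ d → 1 ≤ d' → d ≤ h → d' ≤ h →
                  suc (t * h + (d ∸ 1)) ≡ suc (t' * h + (d' ∸ 1)) → t ≡ t' × d ≡ d'
  own-injective {t} {d} {t'} {d'} 1≤d 1≤d' d≤h d'≤h s≡s'
    with *+-injective h {t} {t'} (d∸1<h 1≤d d≤h) (d∸1<h 1≤d' d'≤h) (suc-injective s≡s')
  ... | t≡t' , d∸1≡d'∸1 = t≡t' , pred-injective {{>-nonZero 1≤d}} {{>-nonZero 1≤d'}} d∸1≡d'∸1

  shared-injective : ∀ {t d t' d'} → Compatible t d t' d' → h < d → d ≤ h + r → h < d' → d' ≤ h + r → t ≡ t' × d ≡ d'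
  shared-injective {t} {d} {t'} {d'} (_ , _ , _ , _ , _ , _ , far) h<d d≤h+r h<d' d'≤h+r with t ≟ t'
  ... | yes t≡t' = t≡t' , ≤-antisym (squeeze d≤h+r h<d') (squeeze d'≤h+r h<d)
    where
    squeeze : ∀ {a b} → a ≤ h + r → h < b → a ≤ b
    squeeze {b = b} a≤h+r h<b = ≤-trans (≤-trans a≤h+r (+-monoʳ-≤ h r≤1)) (subst (_≤ b) (+-comm 1 h) h<b)
  ... | no t≢t' = ⊥-elim (<-irrefl refl (<-≤-trans (beyond-half h<d h<d') (far t≢t')))

  borrowed-injective : ∀ {t d t' d'} → Compatible t d t' d' → h + r < d → h + r < d' →
                       suc (other-branch t * h + (m ∸ d)) ≡ suc (other-branch t' * h + (m ∸ d')) → t ≡ t' × d ≡ d'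
  borrowed-injective {t} {d} {t'} {d'} (_ , _ , _ , d≤m , _ , d'≤m , far) h+r<d h+r<d' s≡s'
    with *+-injective h {other-branch t} {other-branch t'} (m∸d<h h+r<d d≤m) (m∸d<h h+r<d' d'≤m) (suc-injective s≡s')
  ... | _ , m∸d≡m∸d' with t ≟ t'
  ...   | yes t≡t' = t≡t' , ∸-cancelˡ-≡ d≤m d'≤m m∸d≡m∸d'
  ...   | no t≢t' =
    ⊥-elim (<-irrefl refl (<-≤-trans (beyond-half (≤-<-trans (m≤m+n h r) h+r<d) (≤-<-trans (m≤m+n h r) h+r<d')) (far t≢t')))

  slot-injective : ∀ {t d t' d'} → Compatible t d t' d' → slot t d ≡ slot t' d' → t ≡ t' × d ≡ d'
  slot-injective {t} {d} {t'} {d'} c@(t<D , t'<D , 1≤d , d≤m , 1≤d' , d'≤m , _) s≡s'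
    with slot-case t d | slot-case t' d'
  ... | own d≤h e | own d'≤h e' = own-injective 1≤d 1≤d' d≤h d'≤h (trans (sym e) (trans s≡s' e'))
  ... | own d≤h e | shared _ _ e' = ⊥-elim (own≢shared t<D 1≤d d≤h (trans (sym e) (trans s≡s' e')))
  ... | shared _ _ e | own d'≤h e' = ⊥-elim (own≢shared t'<D 1≤d' d'≤h (trans (sym e') (trans (sym s≡s') e)))
  ... | own d≤h e | borrowed h+r<d' e' = ⊥-elim (own≢borrowed c d≤h h+r<d' (trans (sym e) (trans s≡s' e')))
  ... | borrowed h+r<d e | own d'≤h e' =
    ⊥-elim (own≢borrowed (Compatible-sym c) d'≤h h+r<d (trans (sym e') (trans (sym s≡s') e)))
  ... | shared _ _ e | borrowed h+r<d' e' = ⊥-elim (shared≢borrowed {t'} h+r<d' d'≤m (trans (sym e) (trans s≡s' e')))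
  ... | borrowed h+r<d e | shared _ _ e' = ⊥-elim (shared≢borrowed {t} h+r<d d≤m (trans (sym e') (trans (sym s≡s') e)))
  ... | shared h<d d≤h+r _ | shared h<d' d'≤h+r _ = shared-injective c h<d d≤h+r h<d' d'≤h+r
  ... | borrowed h+r<d e | borrowed h+r<d' e' = borrowed-injective c h+r<d h+r<d' (trans (sym e) (trans s≡s' e'))

-- Upper bounds for cliques in a star

module UpperBound (G : FinGraph) (n : ℕ) where
  open FinGraph G using (k)
  open Neighbourhood G
  open Distance G n
  open Star G n

  InStar : Fin k → List Vertex → Set
  InStar c S = All (λ q → δ c q < n) S

  OneBranch : Fin k → List Vertex → Set
  OneBranch c S = ∀ {e e'} → inj₂ e ∈ S → inj₂ e' ∈ S → opposite c e ≡ opposite c e'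

  one-branch-bound : ∀ {m} c {S} → AllPairs (Close m) S → InStar c S → OneBranch c S → length S ≤ suc m
  one-branch-bound {m} c {S} ap star one = pigeonhole f (suc m) ap separated (λ {q} _ → m%n<n (δ c q) (suc m))
    where
    f : Vertex → ℕ
    f q = δ c q % suc m
    f≢0 : ∀ {e} → inj₂ e ∈ S → δ c (inj₂ e) ≤ m → f (inj₂ e) ≢ 0
    f≢0 {e} e∈ δ≤m f≡0 =
      <-irrefl (sym (trans (sym (m<n⇒m%n≡m (s≤s δ≤m))) f≡0)) (δ-end≥1 (at-end e (All.lookup star e∈)))
    separated : ∀ {p q} → p ∈ S → q ∈ S → Close m p q → f p ≢ f q
    separated {inj₁ u} {inj₁ u'} p∈ q∈ (p≢q , _) _
      with δ-original<n⇒≡ (All.lookup star p∈) | δ-original<n⇒≡ (All.lookup star q∈)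
    ... | refl | refl = p≢q refl
    separated {inj₁ u} {inj₂ e} p∈ q∈ (_ , σ≤m , _) fp≡fq with δ-original<n⇒≡ (All.lookup star p∈)
    ... | refl = f≢0 q∈ σ≤m (trans (sym fp≡fq) (cong (_% suc m) (δ-refl u)))
    separated {inj₂ e} {inj₁ u} p∈ q∈ (_ , _ , σ≤m) fp≡fq with δ-original<n⇒≡ (All.lookup star q∈)
    ... | refl = f≢0 p∈ σ≤m (trans fp≡fq (cong (_% suc m) (δ-refl u)))
    separated {inj₂ e} {inj₂ e'} p∈ q∈ (p≢q , σ≤m , _) fp≡fq
      with same-branch (at-end e (All.lookup star p∈)) (at-end e' (All.lookup star q∈)) (one p∈ q∈)
    ... | ∣δ-δ'∣≡σ , δ≡δ'⇒e≡e' =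
      p≢q (cong inj₂ (δ≡δ'⇒e≡e' (≡-mod-suc⇒≡ m (subst (_≤ m) (sym ∣δ-δ'∣≡σ) σ≤m) fp≡fq)))

  branch : Fin k → Internal → ℕ
  branch c e = index (opposite c e) (neighbours c)

  branch<Δ : ∀ {c e} → AtEnd c e → branch c e < Δ G
  branch<Δ {c} {e} at =
    <-≤-trans (subst (branch c e <_) (length-neighbours c) (index<length (∈-neighbours⁺ (opposite-adj at)))) (degree≤Δ c)

  slots-bound : ∀ {m h r} → m < n → (m≡h+h+r : m ≡ h + h + r) (r≤1 : r ≤ 1) (2≤Δ : 2 ≤ Δ G) →
                ∀ c {S} → AllPairs (Close m) S → InStar c S → All (λ q → δ c q ≤ m) S → length S ≤ suc (Δ G * h + r)
  slots-bound {m} {h} {r} m<n m≡h+h+r r≤1 2≤Δ c {S} ap star δ≤m =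
    pigeonhole f (suc (Δ G * h + r)) ap separated bounded
    where
    open Slots m h r (Δ G) m≡h+h+r r≤1 2≤Δ
    at : ∀ {e} → inj₂ e ∈ S → AtEnd c e
    at {e} e∈ = at-end e (All.lookup star e∈)
    f : Vertex → ℕ
    f (inj₁ _) = 0
    f (inj₂ e) = slot (branch c e) (δ c (inj₂ e))
    bounded : ∀ {q} → q ∈ S → f q < suc (Δ G * h + r)
    bounded {inj₁ _} _ = s≤s z≤n
    bounded {inj₂ e} e∈ = slot≤ _ _ (branch<Δ (at e∈)) (δ-end≥1 (at e∈)) (All.lookup δ≤m e∈)
    separated : ∀ {p q} → p ∈ S → q ∈ S → Close m p q → f p ≢ f q
    separated {inj₁ u} {inj₁ u'} p∈ q∈ (p≢q , _) _
      with δ-original<n⇒≡ (All.lookup star p∈) | δ-original<n⇒≡ (All.lookup star q∈)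
    ... | refl | refl = p≢q refl
    separated {inj₁ _} {inj₂ e} _ _ _ fp≡fq = slot≢0 _ _ (sym fp≡fq)
    separated {inj₂ e} {inj₁ _} _ _ _ fp≡fq = slot≢0 _ _ fp≡fq
    separated {inj₂ e} {inj₂ e'} e∈ e'∈ pq@(p≢q , _) fp≡fq =
      p≢q (cong inj₂ (proj₂ (same-branch (at e∈) (at e'∈) same-opposite) (proj₂ same-slot)))
      where
      compatible : Compatible (branch c e) (δ c (inj₂ e)) (branch c e') (δ c (inj₂ e'))
      compatible =
        branch<Δ (at e∈) , branch<Δ (at e'∈) ,
        δ-end≥1 (at e∈) , All.lookup δ≤m e∈ , δ-end≥1 (at e'∈) , All.lookup δ≤m e'∈ ,
        λ t≢t' → Close-different-branches m<n (at e∈) (at e'∈) pq (t≢t' ∘ cong (λ u → index u (neighbours c)))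
      same-slot = slot-injective compatible fp≡fq
      same-opposite : opposite c e ≡ opposite c e'
      same-opposite =
        index-injective (∈-neighbours⁺ (opposite-adj (at e∈))) (∈-neighbours⁺ (opposite-adj (at e'∈))) (proj₁ same-slot)

  star-clique-bound-Δ≡1 : ∀ {m} c {S} → AllPairs (Close m) S → InStar c S → Δ G ≡ 1 → length S ≤ suc m
  star-clique-bound-Δ≡1 c ap star Δ≡1 = one-branch-bound c ap star λ {e} {e'} e∈ e'∈ →
    degree≤1⇒neighbour-unique (subst (degree G c ≤_) Δ≡1 (degree≤Δ c))
      (∈-neighbours⁺ (opposite-adj (at-end e (All.lookup star e∈))))
      (∈-neighbours⁺ (opposite-adj (at-end e' (All.lookup star e'∈))))

  -- A member farther than m from the centre forces all others onto its branch.
  star-clique-bound-Δ≥2 : ∀ {m h r} → m < n → m ≡ h + h + r → r ≤ 1 → 2 ≤ Δ G →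
                          ∀ c {S} → AllPairs (Close m) S → InStar c S → length S ≤ suc (Δ G * h + r)
  star-clique-bound-Δ≥2 {m} {h} {r} m<n m≡h+h+r r≤1 2≤Δ c {S} ap star with All.all? (λ q → δ c q ≤? m) S
  ... | yes δ≤m = slots-bound m<n m≡h+h+r r≤1 2≤Δ c ap star δ≤m
  ... | no ¬δ≤m with find (AllP.¬All⇒Any¬ (λ q → δ c q ≤? m) S ¬δ≤m)
  ...   | inj₁ u , u∈ , far with δ-original<n⇒≡ (All.lookup star u∈)
  ...     | refl = ⊥-elim (far (subst (_≤ m) (sym (δ-refl u)) z≤n))
  star-clique-bound-Δ≥2 {m} {h} {r} m<n m≡h+h+r r≤1 2≤Δ c {S} ap star | no _ | inj₂ f , f∈ , far =
    ≤-trans (one-branch-bound c ap star λ e∈ e'∈ → trans (toward-far e∈) (sym (toward-far e'∈))) (s≤s m≤Δh+r)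
    where
    toward-far : ∀ {e} → inj₂ e ∈ S → opposite c e ≡ opposite c f
    toward-far {e} e∈ with opposite c e F.≟ opposite c f
    ... | yes same = same
    ... | no differ =
      ⊥-elim (far (≤-trans (m≤n+m _ _)
        (Close-different-branches m<n (at-end e (All.lookup star e∈)) (at-end f (All.lookup star f∈))
        (AllPairs-lookup Close-sym ap e∈ f∈ λ { refl → differ refl }) differ)))
    m≤Δh+r : m ≤ Δ G * h + r
    m≤Δh+r = subst (_≤ Δ G * h + r) (sym m≡h+h+r)
      (+-monoˡ-≤ r (subst (_≤ Δ G * h) (cong (h +_) (+-identityʳ h)) (*-monoˡ-≤ h 2≤Δ)))

module Paths (G : FinGraph) (n : ℕ) where
  open FinGraph G using (k)
  open Distance G n
  open Star G n

  snoc : ∀ {x y z l} → Walk Sub x y l → SubE G n y z → Walk Sub x z (suc l)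
  snoc nil e = cons e nil
  snoc (cons e' w) e = cons e' (snoc w e)

  reverse : ∀ {x y l} → Walk Sub x y l → Walk Sub y x l
  reverse nil = nil
  reverse (cons e w) = snoc (reverse w) (Data.Sum.swap e)

  _++ʷ_ : ∀ {x y z l l'} → Walk Sub x y l → Walk Sub y z l' → Walk Sub x z (l + l')
  nil ++ʷ w' = w'
  cons e w ++ʷ w' = cons e (w ++ʷ w')

  module Along (E : EdgeOf G) where
    z w : Fin k
    z = proj₁ E
    w = proj₁ (proj₂ E)

    along-by : (t : ℕ) → Dec (t < n ∸ 1) → Vertex
    along-by t (yes t<n∸1) = inj₂ (E , fromℕ< t<n∸1)
    along-by t (no _) = inj₁ w

    -- along a is the vertex at distance a from z on the path of E (w once a ≥ n).
    along : ℕ → Vertex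
    along zero = inj₁ z
    along (suc t) = along-by t (t <? n ∸ 1)

    along-by-no : ∀ t (d : Dec (t < n ∸ 1)) → ¬ (t < n ∸ 1) → along-by t d ≡ inj₁ w
    along-by-no t (yes t<n∸1) t≮n∸1 = ⊥-elim (t≮n∸1 t<n∸1)
    along-by-no t (no _) _ = refl

    along-n : 1 ≤ n → along n ≡ inj₁ w
    along-n 1≤n = trans (cong along (sym (m+[n∸m]≡n 1≤n))) (along-by-no (n ∸ 1) _ (<-irrefl refl))

    along-internal : ∀ a → 1 ≤ a → a < n → ∃ λ j → along a ≡ inj₂ (E , j) × pos j ≡ a
    along-internal (suc t) _ 1+t<n with t <? n ∸ 1
    ... | yes t<n∸1 = fromℕ< t<n∸1 , refl , cong suc (FP.toℕ-fromℕ< t<n∸1)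
    ... | no t≮n∸1 = ⊥-elim (t≮n∸1 (∸-monoˡ-≤ 1 1+t<n))

    along-step : ∀ a → a < n → SubE G n (along a) (along (suc a))
    along-step zero 0<n with 0 <? n ∸ 1
    ... | yes 0<n∸1 = inj₁ (orig-in E (fromℕ< 0<n∸1) (FP.toℕ-fromℕ< 0<n∸1))
    ... | no 0≮n∸1 = inj₁ (orig-orig E (n≡1 n 0<n 0≮n∸1))
      where
      n≡1 : ∀ n → 0 < n → ¬ (0 < n ∸ 1) → n ≡ 1
      n≡1 (suc zero) _ _ = refl
      n≡1 (suc (suc n)) _ 0≮n∸1 = ⊥-elim (0≮n∸1 (s≤s z≤n))
    along-step (suc t) 1+t<n with t <? n ∸ 1 | suc t <? n ∸ 1
    ... | yes t<n∸1 | yes 1+t<n∸1 =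
      inj₁ (in-in E (fromℕ< t<n∸1) (fromℕ< 1+t<n∸1)
        (trans (FP.toℕ-fromℕ< 1+t<n∸1) (cong suc (sym (FP.toℕ-fromℕ< t<n∸1)))))
    ... | yes t<n∸1 | no 1+t≮n∸1 =
      inj₁ (in-orig E (fromℕ< t<n∸1) (trans (cong suc (FP.toℕ-fromℕ< t<n∸1)) (≤-antisym t<n∸1 (≮⇒≥ 1+t≮n∸1))))
    ... | no t≮n∸1 | _ = ⊥-elim (t≮n∸1 (∸-monoˡ-≤ 1 1+t<n))

    along-walk : ∀ a t → a + t ≤ n → Walk Sub (along a) (along (a + t)) t
    along-walk a zero _ = subst (λ b → Walk Sub (along a) (along b) 0) (sym (+-identityʳ a)) nil
    along-walk a (suc t) a+1+t≤n =
      cons (along-step a (<-≤-trans (m<m+n a (s≤s z≤n)) a+1+t≤n))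
        (subst (λ b → Walk Sub (along (suc a)) (along b) t) (sym (+-suc a t))
          (along-walk (suc a) t (subst (_≤ n) (+-suc a t) a+1+t≤n)))

    δ-along : ∀ a → a < n → δ z (along a) ≡ a
    δ-along zero _ = δ-refl z
    δ-along (suc t) 1+t<n with along-internal (suc t) (s≤s z≤n) 1+t<n
    ... | j , along≡ , pos≡ = trans (cong (δ z) along≡) (trans (δ-first E j) pos≡)

-- Lower bounds: explicit cliques

module LowerBound (G : FinGraph) (n : ℕ) where
  open FinGraph G using (k; adj; irrefl) renaming (sym to adj-sym)
  open Neighbourhood G
  open Distance G n
  open Star G n
  open Paths G n

  path-clique : ∀ {m} → m < n → EdgeOf G → ∃ λ L → AllPairs (PowE Sub m) L × length L ≡ suc m
  path-clique {m} m<n E =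
    L , AllPairs-tabulate unique close , trans (length-map along (upTo (suc m))) (length-upTo (suc m))
    where
    open Along E
    L = map along (upTo (suc m))
    unique : Unique L
    unique = Unique-map⁺-∈ along (UP.upTo⁺ (suc m)) λ {a} {b} a∈ b∈ along≡ →
      trans (sym (δ-along a (<-≤-trans (∈-upTo⁻ a∈) m<n)))
        (trans (cong (δ z) along≡) (δ-along b (<-≤-trans (∈-upTo⁻ b∈) m<n)))
    walk : ∀ {a b} → a ≤ b → b ≤ m → Walk Sub (along a) (along b) (b ∸ a)
    walk {a} {b} a≤b b≤m = subst (λ t → Walk Sub (along a) (along t) (b ∸ a)) (m+[n∸m]≡n a≤b)
      (along-walk a (b ∸ a) (≤-trans (≤-reflexive (m+[n∸m]≡n a≤b)) (≤-trans b≤m (<⇒≤ m<n))))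
    close : ∀ {p q} → p ∈ L → q ∈ L → p ≢ q → PowE Sub m p q
    close p∈ q∈ p≢q with ∈-map⁻ along p∈ | ∈-map⁻ along q∈
    ... | a , a∈ , refl | b , b∈ , refl with ≤-total a b
    ...   | inj₁ a≤b = p≢q , b ∸ a , ≤-trans (m∸n≤m b a) (≤-pred (∈-upTo⁻ b∈)) ,
                       walk a≤b (≤-pred (∈-upTo⁻ b∈))
    ...   | inj₂ b≤a = p≢q , a ∸ b , ≤-trans (m∸n≤m a b) (≤-pred (∈-upTo⁻ a∈)) ,
                       reverse (walk b≤a (≤-pred (∈-upTo⁻ a∈)))

  module Spokes (c : Fin k) where
    adj⇒< : ∀ {u} → adj c u ≡ true → ¬ (toℕ c < toℕ u) → toℕ u < toℕ c
    adj⇒< {u} c∼u c≮u with <-cmp (toℕ u) (toℕ c)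
    ... | tri< u<c _ _ = u<c
    ... | tri≈ _ u≡c _ = ⊥-elim (true≢false (trans (sym c∼u) (trans (cong (adj c) (FP.toℕ-injective u≡c)) (irrefl c))))
      where
      true≢false : true ≢ false
      true≢false ()
    ... | tri> _ _ c<u = ⊥-elim (c≮u c<u)

    spoke-by : ∀ u → ℕ → Dec (adj c u ≡ true) → Dec (toℕ c < toℕ u) → Vertex
    spoke-by u d (yes c∼u) (yes c<u) = Along.along (c , u , c<u , c∼u) d
    spoke-by u d (yes c∼u) (no c≮u) = Along.along (u , c , adj⇒< c∼u c≮u , trans (adj-sym u c) c∼u) (n ∸ d)
    spoke-by u d (no _) _ = inj₁ c

    -- spoke u d is the vertex at distance d from c on the path towards the neighbour u.
    spoke : Fin k → ℕ → Vertex
    spoke u d = spoke-by u d (adj? c u) (toℕ c <? toℕ u)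

    Spoke : Fin k → ℕ → Vertex → Set
    Spoke u d q = (∃ λ e → q ≡ inj₂ e × opposite c e ≡ u × δ c (inj₂ e) ≡ d) × Walk Sub (inj₁ c) q d

    spoke-by-spec : ∀ u d (c∼u? : Dec (adj c u ≡ true)) (c<u? : Dec (toℕ c < toℕ u)) →
                    adj c u ≡ true → 1 ≤ d → d < n → Spoke u d (spoke-by u d c∼u? c<u?)
    spoke-by-spec u d (no c≁u) _ c∼u = ⊥-elim (c≁u c∼u)
    spoke-by-spec u d (yes c∼u) (yes c<u) _ 1≤d d<n with Along.along-internal E d 1≤d d<n
      where E = (c , u , c<u , c∼u)
    ... | j , along≡ , pos≡ =
      ((E , j) , along≡ , opposite-first E j , trans (δ-first E j) pos≡) ,
      Along.along-walk E 0 d (<⇒≤ d<n)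
      where E = (c , u , c<u , c∼u)
    spoke-by-spec u d (yes c∼u) (no c≮u) _ 1≤d d<n
      with Along.along-internal E (n ∸ d) (m<n⇒0<n∸m d<n) (∸-monoʳ-< 1≤d (<⇒≤ d<n))
      where E = (u , c , adj⇒< c∼u c≮u , trans (adj-sym u c) c∼u)
    ... | j , along≡ , pos≡ =
      ((E , j) , along≡ , opposite-second E j , trans (δ-second E j) (trans (cong (n ∸_) pos≡) (m∸[m∸n]≡n (<⇒≤ d<n)))) ,
      reverse (subst (λ q → Walk Sub (Along.along E (n ∸ d)) q d)
        (trans (cong (Along.along E) (m∸n+n≡m (<⇒≤ d<n))) (Along.along-n E (≤-trans 1≤d (<⇒≤ d<n))))
        (Along.along-walk E (n ∸ d) d (≤-reflexive (m∸n+n≡m (<⇒≤ d<n)))))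
      where E = (u , c , adj⇒< c∼u c≮u , trans (adj-sym u c) c∼u)

    spoke-spec : ∀ u d → adj c u ≡ true → 1 ≤ d → d < n → Spoke u d (spoke u d)
    spoke-spec u d = spoke-by-spec u d (adj? c u) (toℕ c <? toℕ u)

    -- The centre c, the vertices at distance 1 … h on every spoke and, for r = 1, the vertex
    -- at distance h + 1 on the spoke towards u₀: any two are joined through c by a walk of
    -- length at most m = h + h + r.
    module StarClique {m h r} (m<n : m < n) (m≡h+h+r : m ≡ h + h + r) (r≤1 : r ≤ 1)
                      (u₀ : Fin k) (c∼u₀ : adj c u₀ ≡ true) where
      Index : Set
      Index = Fin k × ℕ

      grid : List (Fin k) → List Index
      grid [] = []
      grid (u ∷ us) = map (λ d → (u , suc d)) (upTo h) ++ grid us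

      length-grid : ∀ us → length (grid us) ≡ length us * h
      length-grid [] = refl
      length-grid (u ∷ us) = trans (length-++ (map (λ d → (u , suc d)) (upTo h)))
        (cong₂ _+_ (trans (length-map _ (upTo h)) (length-upTo h)) (length-grid us))

      ∈-grid⁻ : ∀ us {a} → a ∈ grid us → proj₁ a ∈ us × 1 ≤ proj₂ a × proj₂ a ≤ h
      ∈-grid⁻ (u ∷ us) a∈ with ∈-++⁻ (map (λ d → (u , suc d)) (upTo h)) a∈
      ... | inj₁ a∈row with ∈-map⁻ (λ d → (u , suc d)) a∈row
      ...   | d , d∈ , refl = here refl , s≤s z≤n , ∈-upTo⁻ d∈
      ∈-grid⁻ (u ∷ us) a∈ | inj₂ a∈rest with ∈-grid⁻ us a∈rest
      ...   | u∈ , 1≤d , d≤h = there u∈ , 1≤d , d≤h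

      grid-unique : ∀ {us} → Unique us → Unique (grid us)
      grid-unique [] = []
      grid-unique {u ∷ us} (u∉ ∷ us!) =
        UP.++⁺ (UP.map⁺ (λ e → suc-injective (cong proj₂ e)) (UP.upTo⁺ h)) (grid-unique us!) disjoint
        where
        disjoint : ∀ {v} → ¬ (v ∈ map (λ d → (u , suc d)) (upTo h) × v ∈ grid us)
        disjoint (v∈row , v∈rest) with ∈-map⁻ (λ d → (u , suc d)) v∈row
        ... | _ , _ , refl = All.lookup u∉ (proj₁ (∈-grid⁻ us v∈rest)) refl

      extra : ℕ → List Index
      extra zero = []
      extra (suc _) = (u₀ , suc h) ∷ []

      length-extra : ∀ {r} → r ≤ 1 → length (extra r) ≡ r
      length-extra {zero} _ = refl
      length-extra {suc zero} _ = refl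
      length-extra {suc (suc _)} (s≤s ())

      ∈-extra⁻ : ∀ r {a} → a ∈ extra r → a ≡ (u₀ , suc h) × 1 ≤ r
      ∈-extra⁻ (suc _) (here refl) = refl , s≤s z≤n

      extra-unique : ∀ r → Unique (extra r)
      extra-unique zero = []
      extra-unique (suc _) = [] ∷ []

      spokes : List Index
      spokes = grid (neighbours c) ++ extra r

      indices : List Index
      indices = (c , 0) ∷ spokes

      data OnSpoke (a : Index) : Set where
        inner : proj₁ a ∈ neighbours c → 1 ≤ proj₂ a → proj₂ a ≤ h → OnSpoke a
        outer : a ≡ (u₀ , suc h) → r ≡ 1 → OnSpoke a

      on-spoke : ∀ {a} → a ∈ spokes → OnSpoke a
      on-spoke a∈ with ∈-++⁻ (grid (neighbours c)) a∈
      ... | inj₁ a∈grid = let (u∈ , 1≤d , d≤h) = ∈-grid⁻ (neighbours c) a∈grid in inner u∈ 1≤d d≤h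
      ... | inj₂ a∈extra = let (a≡ , 1≤r) = ∈-extra⁻ r a∈extra in outer a≡ (≤-antisym r≤1 1≤r)

      index-case : ∀ {a} → a ∈ indices → a ≡ (c , 0) ⊎ OnSpoke a
      index-case (here a≡) = inj₁ a≡
      index-case (there a∈) = inj₂ (on-spoke a∈)

      indices-unique : Unique indices
      indices-unique =
        All.tabulate (λ a∈ → not-centre (on-spoke a∈)) ∷ UP.++⁺ (grid-unique (neighbours-unique c)) (extra-unique r) disjoint
        where
        not-centre : ∀ {a} → OnSpoke a → (c , 0) ≢ a
        not-centre (inner _ 1≤0 _) refl = <-irrefl refl 1≤0
        not-centre (outer () _) refl
        disjoint : ∀ {v} → ¬ (v ∈ grid (neighbours c) × v ∈ extra r)
        disjoint (v∈grid , v∈extra) with ∈-extra⁻ r v∈extra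
        ... | refl , _ = <-irrefl refl (proj₂ (proj₂ (∈-grid⁻ (neighbours c) v∈grid)))

      point : Index → Vertex
      point (_ , zero) = inj₁ c
      point (u , suc d) = spoke u (suc d)

      key : Vertex → Index
      key (inj₁ _) = (c , 0)
      key (inj₂ e) = (opposite c e , δ c (inj₂ e))

      h+h≤m : h + h ≤ m
      h+h≤m = subst (h + h ≤_) (sym m≡h+h+r) (m≤m+n (h + h) r)

      m≡h+1+h : r ≡ 1 → m ≡ h + suc h
      m≡h+1+h refl = trans m≡h+h+r (trans (+-assoc h h 1) (cong (h +_) (+-comm h 1)))

      1+h≤m : r ≡ 1 → suc h ≤ m
      1+h≤m r≡1 = subst (suc h ≤_) (sym (m≡h+1+h r≡1)) (m≤n+m (suc h) h)

      depth≤m : ∀ {a} → OnSpoke a → proj₂ a ≤ m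
      depth≤m (inner _ _ d≤h) = ≤-trans d≤h (≤-trans (m≤m+n h h) h+h≤m)
      depth≤m (outer refl r≡1) = 1+h≤m r≡1

      depth-sum≤m : ∀ {a b} → a ∈ indices → b ∈ indices → a ≢ b → proj₂ a + proj₂ b ≤ m
      depth-sum≤m a∈ b∈ a≢b with index-case a∈ | index-case b∈
      ... | inj₁ refl | inj₁ refl = z≤n
      ... | inj₁ refl | inj₂ b-on = depth≤m b-on
      ... | inj₂ a-on | inj₁ refl = subst (_≤ m) (sym (+-identityʳ _)) (depth≤m a-on)
      ... | inj₂ (inner _ _ d≤h) | inj₂ (inner _ _ d'≤h) = ≤-trans (+-mono-≤ d≤h d'≤h) h+h≤m
      ... | inj₂ (inner _ _ d≤h) | inj₂ (outer refl r≡1) = subst (_ ≤_) (sym (m≡h+1+h r≡1)) (+-monoˡ-≤ (suc h) d≤h)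
      ... | inj₂ (outer refl r≡1) | inj₂ (inner _ _ d'≤h) =
        subst (_ ≤_) (sym (m≡h+1+h r≡1)) (subst (_≤ h + suc h) (+-comm _ (suc h)) (+-monoˡ-≤ (suc h) d'≤h))
      ... | inj₂ (outer refl _) | inj₂ (outer refl _) = ⊥-elim (a≢b refl)

      spoke-point : ∀ {a} → OnSpoke a → Spoke (proj₁ a) (proj₂ a) (point a)
      spoke-point {u , zero} (inner _ () _)
      spoke-point {u , suc d} a-on@(inner u∈ _ _) =
        spoke-spec u (suc d) (∈-neighbours⁻ u∈) (s≤s z≤n) (≤-<-trans (depth≤m a-on) m<n)
      spoke-point a-on@(outer refl _) = spoke-spec u₀ (suc h) c∼u₀ (s≤s z≤n) (≤-<-trans (depth≤m a-on) m<n)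

      point-spec : ∀ {a} → a ∈ indices → key (point a) ≡ a × Walk Sub (inj₁ c) (point a) (proj₂ a)
      point-spec a∈ with index-case a∈
      ... | inj₁ refl = refl , nil
      ... | inj₂ a-on with spoke-point a-on
      ...   | (e , point≡ , opposite≡ , δ≡) , walk = trans (cong key point≡) (cong₂ _,_ opposite≡ δ≡) , walk

      clique : AllPairs (PowE Sub m) (map point indices)
      clique = AllPairs-tabulate (Unique-map⁺-∈ point indices-unique point-injective) adjacent
        where
        point-injective : ∀ {a b} → a ∈ indices → b ∈ indices → point a ≡ point b → a ≡ b
        point-injective a∈ b∈ pa≡pb = trans (sym (proj₁ (point-spec a∈))) (trans (cong key pa≡pb) (proj₁ (point-spec b∈)))
        adjacent : ∀ {p q} → p ∈ map point indices → q ∈ map point indices → p ≢ q → PowE Sub m p q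
        adjacent p∈ q∈ p≢q with ∈-map⁻ point p∈ | ∈-map⁻ point q∈
        ... | a , a∈ , refl | b , b∈ , refl =
          p≢q , proj₂ a + proj₂ b , depth-sum≤m a∈ b∈ (p≢q ∘ cong point) ,
          reverse (proj₂ (point-spec a∈)) ++ʷ proj₂ (point-spec b∈)

      length-clique : length (map point indices) ≡ suc (degree G c * h + r)
      length-clique = trans (length-map point indices) (cong suc (trans (length-++ (grid (neighbours c)))
        (cong₂ _+_ (trans (length-grid (neighbours c)) (cong (_* h) (length-neighbours c))) (length-extra r≤1))))

  some-edge : 1 ≤ Δ G → EdgeOf G
  some-edge 1≤Δ with Δ-attained-with-neighbour 1≤Δ
  ... | c , _ , u , u∈ with toℕ c <? toℕ u
  ...   | yes c<u = c , u , c<u , ∈-neighbours⁻ u∈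
  ...   | no c≮u = u , c , Spokes.adj⇒< c (∈-neighbours⁻ u∈) c≮u , trans (adj-sym u c) (∈-neighbours⁻ u∈)

  star-clique : ∀ {m h r} → m < n → m ≡ h + h + r → r ≤ 1 → 1 ≤ Δ G →
                ∃ λ L → AllPairs (PowE Sub m) L × length L ≡ suc (Δ G * h + r)
  star-clique {m} {h} {r} m<n m≡h+h+r r≤1 1≤Δ with Δ-attained-with-neighbour 1≤Δ
  ... | c , deg≡Δ , u₀ , u₀∈ =
    map point indices , clique , trans length-clique (cong (λ t → suc (t * h + r)) deg≡Δ)
    where open Spokes.StarClique c {m} {h} {r} m<n m≡h+h+r r≤1 u₀ (∈-neighbours⁻ u₀∈)

module _ (G : FinGraph) {m n : ℕ} (m<n : m < n) where
  open Distance G n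
  open Star G n
  open UpperBound G n
  open LowerBound G n

  clique-bound-Δ≡1 : Δ G ≡ 1 → ∀ S → IsClique (FracPowE G m n) S → length S ≤ suc m
  clique-bound-Δ≡1 _ [] _ = z≤n
  clique-bound-Δ≡1 Δ≡1 (p ∷ S) clique with clique-centre m<n (AP.map PowE⇒Close clique)
  ... | c , star = star-clique-bound-Δ≡1 c (AP.map PowE⇒Close clique) star Δ≡1

  clique-bound-Δ≥2 : ∀ {h r} → m ≡ h + h + r → r ≤ 1 → 2 ≤ Δ G →
                     ∀ S → IsClique (FracPowE G m n) S → length S ≤ suc (Δ G * h + r)
  clique-bound-Δ≥2 _ _ _ [] _ = z≤n
  clique-bound-Δ≥2 m≡h+h+r r≤1 2≤Δ (p ∷ S) clique with clique-centre m<n (AP.map PowE⇒Close clique)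
  ... | c , star = star-clique-bound-Δ≥2 m<n m≡h+h+r r≤1 2≤Δ c (AP.map PowE⇒Close clique) star

  ω-Δ≡1 : Δ G ≡ 1 → IsCliqueNumber (FracPowE G m n) (suc m)
  ω-Δ≡1 Δ≡1 = path-clique m<n (some-edge (≤-reflexive (sym Δ≡1))) , clique-bound-Δ≡1 Δ≡1

  ω-Δ≥2 : ∀ {h r} → m ≡ h + h + r → r ≤ 1 → 2 ≤ Δ G → IsCliqueNumber (FracPowE G m n) (suc (Δ G * h + r))
  ω-Δ≥2 m≡h+h+r r≤1 2≤Δ =
    star-clique m<n m≡h+h+r r≤1 (≤-trans (s≤s z≤n) 2≤Δ) , clique-bound-Δ≥2 m≡h+h+r r≤1 2≤Δ

m≡[m/2]+[m/2]+m%2 : ∀ m → m ≡ m / 2 + m / 2 + m % 2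
m≡[m/2]+[m/2]+m%2 m = begin
  m                       ≡⟨ m≡m%n+[m/n]*n m 2 ⟩
  m % 2 + m / 2 * 2       ≡⟨ +-comm (m % 2) (m / 2 * 2) ⟩
  m / 2 * 2 + m % 2       ≡⟨ cong (_+ m % 2) (trans (*-comm (m / 2) 2) (cong (m / 2 +_) (+-identityʳ (m / 2)))) ⟩
  m / 2 + m / 2 + m % 2   ∎
  where open ≡-Reasoning

m%2≤1 : ∀ m → m % 2 ≤ 1
m%2≤1 m = ≤-pred (m%n<n m 2)

[m∸1]/2≡m/2 : ∀ m → m % 2 ≡ 1 → (m ∸ 1) / 2 ≡ m / 2
[m∸1]/2≡m/2 m m%2≡1 = begin
  (m ∸ 1) / 2                  ≡⟨ cong (λ t → (t ∸ 1) / 2) (trans (m≡m%n+[m/n]*n m 2) (cong (_+ m / 2 * 2) m%2≡1)) ⟩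
  (1 + m / 2 * 2 ∸ 1) / 2      ≡⟨ m*n/n≡m (m / 2) 2 ⟩
  m / 2                        ∎
  where open ≡-Reasoning

theorem1 : (G : FinGraph) (m n : ℕ) → m < n →
    ((Δ G ≡ 1 → IsCliqueNumber (FracPowE G m n) (m + 1)) ×
    (2 ≤ Δ G → m % 2 ≡ 0 → IsCliqueNumber (FracPowE G m n) ((m / 2) * Δ G + 1)) ×
    (2 ≤ Δ G → m % 2 ≡ 1 → IsCliqueNumber (FracPowE G m n) (((m ∸ 1) / 2) * Δ G + 2)))
theorem1 G m n m<n =
  (λ Δ≡1 → subst ω-is (+-comm 1 m) (ω-Δ≡1 G m<n Δ≡1)) ,
  (λ 2≤Δ m%2≡0 → subst ω-is (trans count (cong (λ r → m / 2 * Δ G + suc r) m%2≡0)) (ω-Δ≥2′ 2≤Δ)) ,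
  (λ 2≤Δ m%2≡1 → subst ω-is (trans count (cong₂ (λ h r → h * Δ G + suc r) (sym ([m∸1]/2≡m/2 m m%2≡1)) m%2≡1))
                   (ω-Δ≥2′ 2≤Δ))
  where
  ω-is : ℕ → Set
  ω-is = IsCliqueNumber (FracPowE G m n)
  ω-Δ≥2′ : 2 ≤ Δ G → ω-is (suc (Δ G * (m / 2) + m % 2))
  ω-Δ≥2′ = ω-Δ≥2 G m<n (m≡[m/2]+[m/2]+m%2 m) (m%2≤1 m)
  count : suc (Δ G * (m / 2) + m % 2) ≡ m / 2 * Δ G + suc (m % 2)
  count = trans (sym (+-suc (Δ G * (m / 2)) (m % 2))) (cong (_+ suc (m % 2)) (*-comm (Δ G) (m / 2)))
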